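{- For every $n\geqslant0$, $$A_{n+1}(\alpha_1,\alpha_2,\alpha_3,\alpha_4,0)=\sum_{i=0}^n\alpha_4^i\sum_{j=0}^{\lfloor (n-i)/2\rfloor}\gamma_{n,i,j}(1)\,\alpha_1^{j+1}\alpha_2^j(\alpha_3+\alpha_4)^{n-i-2j},$$ where $\gamma_{n,i,j}(1)=\#\{\pi\in\mathfrak{S}_n:{\rm cda}(\pi)=0,\ {\rm fix}(\pi)=i,\ {\rm exc}(\pi)=j\}$.
   Context: For $\pi\in\mathfrak{S}_n$ set $\pi(0)=\pi(n+1)=0$. For $i\in[n]$, $\pi(i)$ is a peak if $\pi(i-1)<\pi(i)>\pi(i+1)$, a valley if $\pi(i-1)>\pi(i)<\pi(i+1)$, a double ascent if $\pi(i-1)<\pi(i)<\pi(i+1)$, a double descent if $\pi(i-1)>\pi(i)>\pi(i+1)$; ${\rm pk},{\rm val},{\rm dasc},{\rm ddes}$ denote their numbers. A value $\pi(i)$ is a simsun succession if $\pi(i)+1$ lies to the right of $\pi(i)$ and all values between them (in position) are greater than $\pi(i)+1$; ${\rm simsuc}(\pi)$ counts them. $A_n(\alpha_1,\alpha_2,\alpha_3,\alpha_4,s)=\sum_{\pi\in\mathfrak{S}_n}\alpha_1^{{\rm pk}(\pi)}\alpha_2^{{\rm val}(\pi)}\alpha_3^{{\rm dasc}(\pi)}\alpha_4^{{\rm ddes}(\pi)}s^{{\rm simsuc}(\pi)}$, so the left side is the sum over $\pi\in\mathfrak{S}_{n+1}$ with ${\rm simsuc}(\pi)=0$. ${\rm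 cda}(\pi)=\#\{a:\pi^{ -1}(a)<a<\pi(a)\}$, ${\rm exc}(\pi)=\#\{i:\pi(i)>i\}$, ${\rm fix}(\pi)=\#\{i:\pi(i)=i\}$. -}

module Defs where

open import Level using (Level)
open import Data.Bool using (Bool; true; false; if_then_else_; _∧_)
open import Data.Nat using (ℕ; zero; suc; _<ᵇ_; _≡ᵇ_; _∸_; ⌊_/2⌋) renaming (_*_ to _*ℕ_)
open import Data.Fin using (Fin; toℕ)
open import Data.Vec using (Vec; []; _∷_; lookup; toList)
open import Data.List using (List; []; _∷_; _++_; map; concatMap; allFin; filter)
open import Data.Bool.ListAction using (any)
open import Data.List.Relation.Unary.Unique.DecPropositional using (unique?)
open import Data.Fin.Properties using () renaming (_≟_ to _≟F_)
open import Algebra.Bundles using (CommutativeSemiring)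

-- The symmetric group 𝔖_n: a permutation π of [n] is represented by its
-- one-line notation, a vector (π(1),…,π(n)) of elements of Fin n
-- (value k ∈ Fin n stands for k+1 ∈ [n]) with pairwise distinct entries.

allVecs : (k m : ℕ) → List (Vec (Fin m) k)
allVecs zero    m = [] ∷ []
allVecs (suc k) m = concatMap (λ x → map (x ∷_) (allVecs k m)) (allFin m)

Perm : ℕ → Set
Perm n = Vec (Fin n) n

𝔖 : (n : ℕ) → List (Perm n)
𝔖 n = filter (λ v → unique? _≟F_ (toList v)) (allVecs n n)

count : {A : Set} → (A → Bool) → List A → ℕ
count p []       = 0
count p (x ∷ xs) = if p x then suc (count p xs) else count p xs

word : {n : ℕ} → Perm n → List ℕ
word v = map (λ x → suc (toℕ x)) (toList v)


-- number of indices i ∈ [n] such that the triple (π(i-1),π(i),π(i+1)),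
-- with the convention π(0)=π(n+1)=0, satisfies p
countTriples : (ℕ → ℕ → ℕ → Bool) → List ℕ → ℕ
countTriples p (a ∷ b ∷ c ∷ xs) =
  (if p a b c then 1 else 0) Data.Nat.+ countTriples p (b ∷ c ∷ xs)
countTriples p _ = 0

padded : {n : ℕ} → Perm n → List ℕ
padded v = 0 ∷ (word v ++ (0 ∷ []))

pk val dasc ddes : {n : ℕ} → Perm n → ℕ
pk   v = countTriples (λ a b c → (a <ᵇ b) ∧ (c <ᵇ b)) (padded v)
val  v = countTriples (λ a b c → (b <ᵇ a) ∧ (b <ᵇ c)) (padded v)
dasc v = countTriples (λ a b c → (a <ᵇ b) ∧ (b <ᵇ c)) (padded v)
ddes v = countTriples (λ a b c → (b <ᵇ a) ∧ (c <ᵇ b)) (padded v)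

succAt : ℕ → List ℕ → Bool
succAt a []       = false
succAt a (x ∷ xs) =
  if x ≡ᵇ suc a then true else (if suc a <ᵇ x then succAt a xs else false)

simsucW : List ℕ → ℕ
simsucW []       = 0
simsucW (x ∷ xs) = (if succAt x xs then 1 else 0) Data.Nat.+ simsucW xs

simsuc : {n : ℕ} → Perm n → ℕ
simsuc v = simsucW (word v)

-- exc, fix, cda (indices/values shifted by one uniformly, which does not
-- affect any of the comparisons)
exc fix cda : {n : ℕ} → Perm n → ℕ
exc {n} v = count (λ i → toℕ i <ᵇ toℕ (lookup v i)) (allFin n)
fix {n} v = count (λ i → toℕ (lookup v i) ≡ᵇ toℕ i) (allFin n)
cda {n} v = count (λ a → (toℕ a <ᵇ toℕ (lookup v a))
                       ∧ any (λ i → (toℕ i <ᵇ toℕ a) ∧ (toℕ (lookup v i) ≡ᵇ toℕ a))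
                             (allFin n))
                  (allFin n)

γ1 : ℕ → ℕ → ℕ → ℕ
γ1 n i j = count (λ v → (cda v ≡ᵇ 0) ∧ (fix v ≡ᵇ i) ∧ (exc v ≡ᵇ j)) (𝔖 n)

-- Polynomial identities are stated in an arbitrary commutative semiring
-- (equivalent to an identity in ℕ[α₁,α₂,α₃,α₄,s]).

module _ {c ℓ : Level} (R : CommutativeSemiring c ℓ) where
  open CommutativeSemiring R

  pow : Carrier → ℕ → Carrier
  pow x zero    = 1#
  pow x (suc k) = x * pow x k

  nat : ℕ → Carrier
  nat zero    = 0#
  nat (suc m) = 1# + nat m

  sumList : {A : Set} → (A → Carrier) → List A → Carrier
  sumList f []       = 0#
  sumList f (x ∷ xs) = f x + sumList f xs

  sumTo : ℕ → (ℕ → Carrier) → Carrier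
  sumTo zero    f = f 0
  sumTo (suc m) f = sumTo m f + f (suc m)

  A : ℕ → Carrier → Carrier → Carrier → Carrier → Carrier → Carrier
  A n α₁ α₂ α₃ α₄ s =
    sumList (λ π → pow α₁ (pk π) * pow α₂ (val π) * pow α₃ (dasc π)
                   * pow α₄ (ddes π) * pow s (simsuc π)) (𝔖 n)

  rhs : ℕ → Carrier → Carrier → Carrier → Carrier → Carrier
  rhs n α₁ α₂ α₃ α₄ =
    sumTo n (λ i → pow α₄ i *
      sumTo ⌊ (n ∸ i) /2⌋ (λ j →
        nat (γ1 n i j) * pow α₁ (suc j) * pow α₂ j
          * pow (α₃ + α₄) (n ∸ i ∸ 2 *ℕ j)))

{-# OPTIONS --safe #-}

-- Both sides obey the same recursion in n.  The recursions are compared in the dual numbers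
-- R[ε]/(ε²), where summing over all ways of inserting one new element becomes a derivation.
--
-- Linear side: inserting a new maximum into a gap of a word changes the shape of exactly one old
-- letter, the larger neighbour of the gap, and creates a simsun succession exactly when it lands
-- right after the old maximum.  So if A^ω_{n+1} denotes A_{n+1}(α, 0) with the peak at the maximum
-- weighted ω, then A^ω_{n+2} is the ε-part of A^{α₁ + ε ωα₄}_{n+1} at α + ε (ω(α₃ + α₄), 0, ωα₂, ωα₂).
--
-- Cyclic side: inserting a new minimum as a fixed point, or right after some a in its cycle,
-- changes the cycle shape of exactly one element (a or π(a)).  So the polynomial Cyc_n(q, x, y, f)
-- weighting cycle valleys, double ascents, double descents and fixed points satisfies
-- Cyc_{n+1} = f Cyc_n + (ε-part of Cyc_n at (q, x, y, f) + ε (q(x + y), q, q, q)), and hence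
-- depends on x and y only through x + y.
--
-- Every statement holds in all commutative semirings, so the induction can be run over the dual
-- numbers themselves; it gives A_{n+1}(α, 0) = α₁ Cyc_n(α₁α₂, 0, α₃ + α₄, α₄).  With x = 0 only
-- permutations with cda = 0 survive; for them cycle peaks and cycle valleys are equinumerous (both
-- count excedances), so the weight is α₄^fix (α₁α₂)^exc (α₃ + α₄)^(n − fix − 2 exc), and grouping
-- by fix and exc yields the γ_{n,i,j}(1).

module Submission where

open import Level using (Level)
open import Function using (_∘_; _∘₂_; id; case_of_; _⇔_; mk⇔; Equivalence)
open import Function.Definitions using (Injective)
open import Data.Empty using (⊥; ⊥-elim)
open import Data.Bool using (Bool; true; false; if_then_else_; _∧_; _∨_)
open import Data.Bool.ListAction using (any)
import Data.Bool.Properties as Boolₚ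
open import Data.Nat as ℕ using (ℕ; zero; suc; _<_; _≤_; _∸_; _<ᵇ_; _≡ᵇ_; z<s; s<s; s≤s; z≤n; ⌊_/2⌋)
import Data.Nat.Properties as ℕₚ
open import Data.Fin as Fin using (Fin; zero; suc; toℕ; punchIn; punchOut; inject₁; fromℕ)
import Data.Fin.Properties as Finₚ
open import Data.Fin.Permutation using (Permutation; permutation)
open import Data.Product using (_×_; _,_; proj₁; proj₂; ∃; ∃₂)
open import Data.Product.Properties using (,-injective)
open import Data.Product.Relation.Binary.Pointwise.NonDependent using (Pointwise; ×-isEquivalence)
open import Data.Sum using (_⊎_; inj₁; inj₂)
open import Data.Vec as Vec using (Vec; []; _∷_; lookup; toList)
import Data.Vec.Properties as Vecₚ
open import Data.Vec.Functional using (removeAt)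
open import Data.List as List using (List; []; _∷_; _++_; map; allFin; tabulate; cartesianProductWith)
open import Data.List.Relation.Unary.All as All using (All; []; _∷_)
open import Data.List.Relation.Unary.Any using (here; there)
open import Data.List.Relation.Unary.AllPairs using ([]; _∷_)
open import Data.List.Relation.Unary.Unique.Propositional using (Unique)
import Data.List.Relation.Unary.Unique.Propositional.Properties as Uniqueₚ
open import Data.List.Relation.Unary.Unique.DecPropositional using (unique?)
open import Data.List.Membership.Propositional using (_∈_)
open import Data.List.Membership.Propositional.Properties
  using (∈-allFin; ∈-filter⁺; ∈-filter⁻; ∈-cartesianProductWith⁺; ∈-cartesianProductWith⁻)
open import Data.List.Membership.Propositional.Properties.WithK using (unique∧set⇒bag)
open import Data.List.Relation.Binary.Permutation.Propositional as ↭ using (_↭_)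
open import Data.List.Relation.Binary.BagAndSetEquality using (∼bag⇒↭)
open import Relation.Binary.PropositionalEquality as ≡ using (_≡_; _≢_)
open import Relation.Binary.Definitions using (tri<; tri≈; tri>)
open import Relation.Nullary using (yes; no)
open import Algebra.Bundles using (CommutativeSemiring; CommutativeMonoid)
open import Algebra.Structures.Biased using (IsCommutativeSemiringˡ)
open import Algebra.Morphism.Bundles using (SemiringHomomorphism)
import Algebra.Construct.DirectProduct as DirectProduct
import Algebra.Properties.Semiring.Sum as SemiringSum
import Algebra.Properties.CommutativeMonoid.Sum as MonoidSum
import Algebra.Solver.Ring.NaturalCoefficients.Default as NaturalSolver

open import Defs

<ᵇ-true : ∀ {a b} → a < b → (a <ᵇ b) ≡ true
<ᵇ-true a<b = Equivalence.to Boolₚ.T-≡ (ℕₚ.<⇒<ᵇ a<b)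

<ᵇ-false : ∀ {a b} → b ≤ a → (a <ᵇ b) ≡ false
<ᵇ-false {a} {b} b≤a = Boolₚ.¬-not (λ a<ᵇb≡true → ℕₚ.≤⇒≯ b≤a (ℕₚ.<ᵇ⇒< a b (Equivalence.from Boolₚ.T-≡ a<ᵇb≡true)))

≡ᵇ-true : ∀ a → (a ≡ᵇ a) ≡ true
≡ᵇ-true a = Equivalence.to Boolₚ.T-≡ (ℕₚ.≡⇒≡ᵇ a a ≡.refl)

≡ᵇ-false : ∀ {a b} → a ≢ b → (a ≡ᵇ b) ≡ false
≡ᵇ-false {a} {b} a≢b = Boolₚ.¬-not (λ a≡ᵇb≡true → a≢b (ℕₚ.≡ᵇ⇒≡ a b (Equivalence.from Boolₚ.T-≡ a≡ᵇb≡true)))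

indicator : Bool → ℕ
indicator b = if b then 1 else 0

-- Dual numbers and finite sums

module _ {c ℓ : Level} (R : CommutativeSemiring c ℓ) where
  open CommutativeSemiring R hiding (zero)
  open NaturalSolver R

  -- R[ε]/(ε²): the pair (a , b) stands for a + b ε.
  dualNumbers : CommutativeSemiring c ℓ
  dualNumbers = record
    { Carrier = Carrier × Carrier
    ; _≈_     = Pointwise _≈_ _≈_
    ; _+_     = CommutativeMonoid._∙_ sums
    ; _*_     = _⊛_
    ; 0#      = 0# , 0#
    ; 1#      = 1# , 0#
    ; isCommutativeSemiring = IsCommutativeSemiringˡ.isCommutativeSemiring record
      { +-isCommutativeMonoid = CommutativeMonoid.isCommutativeMonoid sums
      ; *-isCommutativeMonoid = record
        { isMonoid = record
          { isSemigroup = record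
            { isMagma = record
              { isEquivalence = ×-isEquivalence isEquivalence isEquivalence
              ; ∙-cong = λ (p , p′) (q , q′) → *-cong p q , +-cong (*-cong p q′) (*-cong p′ q)
              }
            ; assoc = λ (a , a′) (b , b′) (d , d′) → *-assoc a b d ,
                solve 6 (λ a a′ b b′ d d′ → (a :* b) :* d′ :+ (a :* b′ :+ a′ :* b) :* d
                                         := a :* (b :* d′ :+ b′ :* d) :+ a′ :* (b :* d))
                      refl a a′ b b′ d d′
            }
          ; identity = (λ (a , a′) → *-identityˡ a , solve 2 (λ a a′ → con 1 :* a′ :+ con 0 :* a := a′) refl a a′)
                     , (λ (a , a′) → *-identityʳ a , solve 2 (λ a a′ → a :* con 0 :+ a′ :* con 1 := a′) refl a a′)
          }
        ; comm = λ (a , a′) (b , b′) → *-comm a b , solve 4 (λ a a′ b b′ → a :* b′ :+ a′ :* b := b :* a′ :+ b′ :* a) refl a a′ b b′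
        }
      ; distribʳ = λ (a , a′) (b , b′) (d , d′) → distribʳ a b d ,
          solve 6 (λ a a′ b b′ d d′ → (b :+ d) :* a′ :+ (b′ :+ d′) :* a := (b :* a′ :+ b′ :* a) :+ (d :* a′ :+ d′ :* a))
                refl a a′ b b′ d d′
      ; zeroˡ = λ (a , a′) → zeroˡ a , solve 2 (λ a a′ → con 0 :* a′ :+ con 0 :* a := con 0) refl a a′
      }
    }
    where
    sums : CommutativeMonoid c ℓ
    sums = DirectProduct.commutativeMonoid +-commutativeMonoid +-commutativeMonoid
    _⊛_ : Carrier × Carrier → Carrier × Carrier → Carrier × Carrier
    (a , a′) ⊛ (b , b′) = a * b , a * b′ + a′ * b

Homomorphism : ∀ {c₁ ℓ₁ c₂ ℓ₂} → CommutativeSemiring c₁ ℓ₁ → CommutativeSemiring c₂ ℓ₂ → Set _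
Homomorphism R₁ R₂ =
  SemiringHomomorphism (CommutativeSemiring.rawSemiring R₁) (CommutativeSemiring.rawSemiring R₂)

module _ {c₁ ℓ₁ c₂ ℓ₂} (R₁ : CommutativeSemiring c₁ ℓ₁) (R₂ : CommutativeSemiring c₂ ℓ₂) where
  private
    module R₁ = CommutativeSemiring R₁
    module R₂ = CommutativeSemiring R₂

  mkHomomorphism : (f : R₁.Carrier → R₂.Carrier) →
    (∀ {x y} → x R₁.≈ y → f x R₂.≈ f y) →
    (∀ x y → f (x R₁.+ y) R₂.≈ f x R₂.+ f y) →
    (∀ x y → f (x R₁.* y) R₂.≈ f x R₂.* f y) →
    f R₁.0# R₂.≈ R₂.0# → f R₁.1# R₂.≈ R₂.1# → Homomorphism R₁ R₂
  mkHomomorphism f f-cong +-homo *-homo 0#-homo 1#-homo = record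
    { ⟦_⟧ = f
    ; isSemiringHomomorphism = record
      { isNearSemiringHomomorphism = record
        { +-isMonoidHomomorphism = record
          { isMagmaHomomorphism = record { isRelHomomorphism = record { cong = f-cong } ; homo = +-homo }
          ; ε-homo = 0#-homo
          }
        ; *-homo = *-homo
        }
      ; 1#-homo = 1#-homo
      }
    }

module _ {c ℓ : Level} (R : CommutativeSemiring c ℓ) where
  open CommutativeSemiring R hiding (zero)
  open NaturalSolver R

  primalPart : Homomorphism (dualNumbers R) R
  primalPart = mkHomomorphism (dualNumbers R) R proj₁ proj₁ (λ _ _ → refl) (λ _ _ → refl) refl refl

  scaleTangent : Carrier → Homomorphism (dualNumbers R) (dualNumbers R)
  scaleTangent k = mkHomomorphism (dualNumbers R) (dualNumbers R) (λ (a , a′) → a , k * a′) (λ (p , p′) → p , *-cong refl p′)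
    (λ _ _ → refl , distribˡ k _ _)
    (λ (a , a′) (b , b′) → refl ,
      solve 5 (λ k a a′ b b′ → k :* (a :* b′ :+ a′ :* b) := a :* (k :* b′) :+ (k :* a′) :* b) refl k a a′ b b′)
    (refl , zeroʳ k) (refl , zeroʳ k)

module FinSums {c ℓ : Level} (R : CommutativeSemiring c ℓ) where
  open CommutativeSemiring R hiding (zero)
  open SemiringSum semiring public using (sum; sum-cong-≋; ∑-distrib-+; *-distribˡ-sum; ∑-permute)
  open MonoidSum *-commutativeMonoid public using () renaming (sum to product; sum-cong-≋ to product-cong-≋; sum-remove to product-remove)

  productWithout : ∀ {n} → (Fin n → Carrier) → Fin n → Carrier
  productWithout {suc n} g b = product (removeAt g b)

module _ {c ℓ : Level} (R : CommutativeSemiring c ℓ) where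
  open CommutativeSemiring R hiding (zero)
  open FinSums R
  open import Relation.Binary.Reasoning.Setoid setoid

  sumList-cong-∈ : ∀ {A : Set} {f g : A → Carrier} (xs : List A) →
    (∀ x → x ∈ xs → f x ≈ g x) → sumList R f xs ≈ sumList R g xs
  sumList-cong-∈ []       f≈g = refl
  sumList-cong-∈ (x ∷ xs) f≈g = +-cong (f≈g x (here ≡.refl)) (sumList-cong-∈ xs (λ y → f≈g y ∘ there))

  sumList-++ : ∀ {A : Set} (f : A → Carrier) (xs ys : List A) →
    sumList R f (xs ++ ys) ≈ sumList R f xs + sumList R f ys
  sumList-++ f []       ys = sym (+-identityˡ _)
  sumList-++ f (x ∷ xs) ys = trans (+-cong refl (sumList-++ f xs ys)) (sym (+-assoc _ _ _))

  sumList-map : ∀ {A B : Set} (f : B → Carrier) (g : A → B) (xs : List A) →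
    sumList R f (map g xs) ≡ sumList R (f ∘ g) xs
  sumList-map f g []       = ≡.refl
  sumList-map f g (x ∷ xs) = ≡.cong (f (g x) +_) (sumList-map f g xs)

  sumList-+ : ∀ {A : Set} (f g : A → Carrier) (xs : List A) →
    sumList R (λ x → f x + g x) xs ≈ sumList R f xs + sumList R g xs
  sumList-+ f g []       = sym (+-identityʳ 0#)
  sumList-+ f g (x ∷ xs) = trans (+-cong refl (sumList-+ f g xs)) (interchange _ _ _ _)
    where open import Algebra.Properties.CommutativeSemigroup +-commutativeSemigroup using (interchange)

  *-distribˡ-sumList : ∀ {A : Set} x (f : A → Carrier) (xs : List A) →
    x * sumList R f xs ≈ sumList R (λ y → x * f y) xs
  *-distribˡ-sumList x f []       = zeroʳ x
  *-distribˡ-sumList x f (y ∷ xs) = trans (distribˡ x _ _) (+-cong refl (*-distribˡ-sumList x f xs))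

  sumList-↭ : ∀ {A : Set} (f : A → Carrier) {xs ys : List A} → xs ↭ ys → sumList R f xs ≈ sumList R f ys
  sumList-↭ f ↭.refl          = refl
  sumList-↭ f (↭.prep x p)    = +-cong refl (sumList-↭ f p)
  sumList-↭ f (↭.swap x y p)  = trans (x∙yz≈y∙xz _ _ _) (+-cong refl (+-cong refl (sumList-↭ f p)))
    where open import Algebra.Properties.CommutativeSemigroup +-commutativeSemigroup using (x∙yz≈y∙xz)
  sumList-↭ f (↭.trans p q)   = trans (sumList-↭ f p) (sumList-↭ f q)

  sumList-tabulate : ∀ {A : Set} {n} (f : A → Carrier) (g : Fin n → A) → sumList R f (tabulate g) ≈ sum (f ∘ g)
  sumList-tabulate {n = zero}  f g = refl
  sumList-tabulate {n = suc n} f g = +-cong refl (sumList-tabulate f (g ∘ suc))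

  sumList-cartesianProductWith : ∀ {A B C : Set} (f : C → Carrier) (g : A → B → C) (xs : List A) (ys : List B) →
    sumList R f (cartesianProductWith g xs ys) ≈ sumList R (λ x → sumList R (f ∘ g x) ys) xs
  sumList-cartesianProductWith f g []       ys = refl
  sumList-cartesianProductWith f g (x ∷ xs) ys = begin
    sumList R f (map (g x) ys ++ cartesianProductWith g xs ys)
      ≈⟨ sumList-++ f (map (g x) ys) _ ⟩
    sumList R f (map (g x) ys) + sumList R f (cartesianProductWith g xs ys)
      ≈⟨ +-cong (reflexive (sumList-map f (g x) ys)) (sumList-cartesianProductWith f g xs ys) ⟩
    sumList R (f ∘ g x) ys + sumList R (λ x → sumList R (f ∘ g x) ys) xs ∎

module _ {c₁ ℓ₁ c₂ ℓ₂} (R₁ : CommutativeSemiring c₁ ℓ₁) (R₂ : CommutativeSemiring c₂ ℓ₂)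
         (h : Homomorphism R₁ R₂) where
  open SemiringHomomorphism h
  private
    module R₁ = CommutativeSemiring R₁
  open CommutativeSemiring R₂ hiding (zero)

  sumList-homo : ∀ {A : Set} (f : A → R₁.Carrier) (xs : List A) → ⟦ sumList R₁ f xs ⟧ ≈ sumList R₂ (⟦_⟧ ∘ f) xs
  sumList-homo f []       = 0#-homo
  sumList-homo f (x ∷ xs) = trans (+-homo _ _) (+-cong refl (sumList-homo f xs))

  product-homo : ∀ {n} (f : Fin n → R₁.Carrier) → ⟦ FinSums.product R₁ f ⟧ ≈ FinSums.product R₂ (⟦_⟧ ∘ f)
  product-homo {zero}  f = 1#-homo
  product-homo {suc n} f = trans (*-homo _ _) (*-cong refl (product-homo (f ∘ suc)))

module _ {c ℓ : Level} (R : CommutativeSemiring c ℓ) where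
  open CommutativeSemiring R hiding (zero)
  open FinSums R
  private module D = FinSums (dualNumbers R)
  open import Relation.Binary.Reasoning.Setoid setoid

  sumList-tangent : ∀ {A : Set} (f : A → Carrier × Carrier) (xs : List A) →
    proj₂ (sumList (dualNumbers R) f xs) ≈ sumList R (proj₂ ∘ f) xs
  sumList-tangent f []       = refl
  sumList-tangent f (x ∷ xs) = +-cong refl (sumList-tangent f xs)

  productWithout-suc : ∀ {n} (g : Fin (suc n) → Carrier) (b : Fin n) →
    productWithout g (suc b) ≡ g zero * productWithout (g ∘ suc) b
  productWithout-suc {suc n} g b = ≡.refl

  product-tangent : ∀ {n} (h : Fin n → Carrier × Carrier) →
    proj₂ (D.product h) ≈ sum (λ b → proj₂ (h b) * productWithout (proj₁ ∘ h) b)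
  product-tangent {zero}  h = refl
  product-tangent {suc n} h = begin
    h₀ * proj₂ (D.product (h ∘ suc)) + h₀′ * proj₁ (D.product (h ∘ suc))
      ≈⟨ +-cong (*-cong refl (product-tangent (h ∘ suc))) (*-cong refl (product-homo (dualNumbers R) R (primalPart R) (h ∘ suc))) ⟩
    h₀ * sum others + h₀′ * product (g ∘ suc)
      ≈⟨ +-comm _ _ ⟩
    h₀′ * product (g ∘ suc) + h₀ * sum others
      ≈⟨ +-cong refl (*-distribˡ-sum h₀ others) ⟩
    h₀′ * product (g ∘ suc) + sum (λ b → h₀ * others b)
      ≈⟨ +-cong refl (sum-cong-≋ {x = λ b → h₀ * others b} {y = λ b → proj₂ (h (suc b)) * productWithout g (suc b)}
                       (λ b → trans (x∙yz≈y∙xz _ _ _) (*-cong refl (reflexive (≡.sym (productWithout-suc g b)))))) ⟩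
    h₀′ * product (g ∘ suc) + sum (λ b → proj₂ (h (suc b)) * productWithout g (suc b)) ∎
    where
    open import Algebra.Properties.CommutativeSemigroup *-commutativeSemigroup using (x∙yz≈y∙xz)
    g = proj₁ ∘ h
    h₀ = proj₁ (h zero)
    h₀′ = proj₂ (h zero)
    others : Fin n → Carrier
    others b = proj₂ (h (suc b)) * productWithout (g ∘ suc) b

module _ {c ℓ : Level} (R : CommutativeSemiring c ℓ) where
  open CommutativeSemiring R hiding (zero)
  open NaturalSolver R

  pow-+ : ∀ x a b → pow R x (a ℕ.+ b) ≈ pow R x a * pow R x b
  pow-+ x zero    b = sym (*-identityˡ _)
  pow-+ x (suc a) b = trans (*-cong refl (pow-+ x a b)) (sym (*-assoc _ _ _))

  pow-* : ∀ x y k → pow R (x * y) k ≈ pow R x k * pow R y k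
  pow-* x y zero    = sym (*-identityˡ 1#)
  pow-* x y (suc k) = trans (*-cong refl (pow-* x y k)) (solve 4 (λ x y a b → (x :* y) :* (a :* b) := (x :* a) :* (y :* b)) refl _ _ _ _)

  pow-indicator : ∀ x b → pow R x (indicator b) ≈ (if b then x else 1#)
  pow-indicator x true  = *-identityʳ x
  pow-indicator x false = refl

module _ {c ℓ : Level} (R : CommutativeSemiring c ℓ) where
  open CommutativeSemiring R hiding (zero)

  sumTo-cong : ∀ N {F G : ℕ → Carrier} → (∀ i → F i ≈ G i) → sumTo R N F ≈ sumTo R N G
  sumTo-cong zero    F≈G = F≈G 0
  sumTo-cong (suc N) F≈G = +-cong (sumTo-cong N F≈G) (F≈G (suc N))

  *-distribˡ-sumTo : ∀ N x (F : ℕ → Carrier) → x * sumTo R N F ≈ sumTo R N (λ i → x * F i)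
  *-distribˡ-sumTo zero    x F = refl
  *-distribˡ-sumTo (suc N) x F = trans (distribˡ x _ _) (+-cong (*-distribˡ-sumTo N x F) refl)

  sumTo-sumList : ∀ {A : Set} N (F : ℕ → A → Carrier) (xs : List A) →
    sumTo R N (λ i → sumList R (F i) xs) ≈ sumList R (λ a → sumTo R N (λ i → F i a)) xs
  sumTo-sumList zero    F xs = refl
  sumTo-sumList (suc N) F xs = trans (+-cong (sumTo-sumList N F xs) refl) (sym (sumList-+ R _ _ xs))

  sumTo-zero : ∀ N (F : ℕ → Carrier) → (∀ i → i ≤ N → F i ≈ 0#) → sumTo R N F ≈ 0#
  sumTo-zero zero    F F≈0 = F≈0 0 z≤n
  sumTo-zero (suc N) F F≈0 = trans (+-cong (sumTo-zero N F (λ i → F≈0 i ∘ ℕₚ.m≤n⇒m≤1+n)) (F≈0 (suc N) ℕₚ.≤-refl)) (+-identityʳ 0#)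

  sumTo-single : ∀ N k (F : ℕ → Carrier) → k ≤ N → (∀ i → i ≢ k → F i ≈ 0#) → sumTo R N F ≈ F k
  sumTo-single zero    zero F _   _      = refl
  sumTo-single (suc N) k    F k≤N others with k ℕₚ.≟ suc N
  ... | yes ≡.refl = trans (+-cong (sumTo-zero N F (λ i i≤N → others i (ℕₚ.<⇒≢ (s≤s i≤N)))) refl) (+-identityˡ _)
  ... | no  k≢1+N  = trans (+-cong (sumTo-single N k F (ℕₚ.≤-pred (ℕₚ.≤∧≢⇒< k≤N k≢1+N)) others) (others (suc N) (k≢1+N ∘ ≡.sym)))
                           (+-identityʳ _)

  nat-count : ∀ {A : Set} (p : A → Bool) (xs : List A) → nat R (count p xs) ≈ sumList R (λ a → if p a then 1# else 0#) xs
  nat-count p []       = refl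
  nat-count p (x ∷ xs) with p x
  ... | true  = +-cong refl (nat-count p xs)
  ... | false = trans (nat-count p xs) (sym (+-identityˡ _))

-- Permutations as injective vectors

module _ {A : Set} where

  ∈-toList : ∀ {k} (v : Vec A k) (j : Fin k) → lookup v j ∈ toList v
  ∈-toList (x ∷ v) zero    = here ≡.refl
  ∈-toList (x ∷ v) (suc j) = there (∈-toList v j)

  ∈-toList⁻ : ∀ {k} (v : Vec A k) {z} → z ∈ toList v → ∃ λ j → lookup v j ≡ z
  ∈-toList⁻ (x ∷ v) (here z≡x) = zero , ≡.sym z≡x
  ∈-toList⁻ (x ∷ v) (there z∈v) with j , vj≡z ← ∈-toList⁻ v z∈v = suc j , vj≡z

  Unique-toList⇒lookup-injective : ∀ {k} (v : Vec A k) → Unique (toList v) → Injective _≡_ _≡_ (lookup v)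
  Unique-toList⇒lookup-injective (x ∷ v) (x∉v ∷ u) {zero}  {zero}  _ = ≡.refl
  Unique-toList⇒lookup-injective (x ∷ v) (x∉v ∷ u) {zero}  {suc j} e = ⊥-elim (All.lookup x∉v (∈-toList v j) e)
  Unique-toList⇒lookup-injective (x ∷ v) (x∉v ∷ u) {suc i} {zero}  e = ⊥-elim (All.lookup x∉v (∈-toList v i) (≡.sym e))
  Unique-toList⇒lookup-injective (x ∷ v) (x∉v ∷ u) {suc i} {suc j} e = ≡.cong suc (Unique-toList⇒lookup-injective v u e)

  lookup-injective⇒Unique-toList : ∀ {k} (v : Vec A k) → Injective _≡_ _≡_ (lookup v) → Unique (toList v)
  lookup-injective⇒Unique-toList []      inj = []
  lookup-injective⇒Unique-toList (x ∷ v) inj =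
    All.tabulate x∉v ∷ lookup-injective⇒Unique-toList v (Finₚ.suc-injective ∘ inj)
    where
    x∉v : ∀ {z} → z ∈ toList v → x ≢ z
    x∉v z∈v x≡z with j , vj≡z ← ∈-toList⁻ v z∈v with () ← inj {zero} {suc j} (≡.trans x≡z (≡.sym vj≡z))

IsPermutation : ∀ {n} → Perm n → Set
IsPermutation π = Injective _≡_ _≡_ (lookup π)

IsPermutation⇒surjective : ∀ {n} (π : Perm n) → IsPermutation π → ∀ y → ∃ λ i → lookup π i ≡ y
IsPermutation⇒surjective {n} π inj y with Finₚ.any? (λ i → lookup π i Finₚ.≟ y)
... | yes hit = hit
IsPermutation⇒surjective {suc n} π inj y | no miss =
  ⊥-elim (collision (Finₚ.pigeonhole (ℕₚ.n<1+n n) (λ i → punchOut (y≢π i))))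
  where
  y≢π : ∀ i → y ≢ lookup π i
  y≢π i y≡πi = miss (i , ≡.sym y≡πi)
  collision : (∃₂ λ i j → i Fin.< j × punchOut (y≢π i) ≡ punchOut (y≢π j)) → ⊥
  collision (i , j , i<j , eq) = Finₚ.<⇒≢ i<j (inj (Finₚ.punchOut-injective (y≢π i) (y≢π j) eq))

preimage : ∀ {n} (π : Perm n) → IsPermutation π → Fin n → Fin n
preimage π inj y = proj₁ (IsPermutation⇒surjective π inj y)

lookup-preimage : ∀ {n} (π : Perm n) (inj : IsPermutation π) y → lookup π (preimage π inj y) ≡ y
lookup-preimage π inj y = proj₂ (IsPermutation⇒surjective π inj y)

toPermutation : ∀ {n} (π : Perm n) → IsPermutation π → Permutation n n
toPermutation π inj = permutation (lookup π) (preimage π inj) (lookup-preimage π inj) (λ x → inj (lookup-preimage π inj (lookup π x)))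

allVecs≡cartesianProduct : ∀ k m → allVecs (suc k) m ≡ cartesianProductWith _∷_ (allFin m) (allVecs k m)
allVecs≡cartesianProduct k m = go (allFin m)
  where
  go : ∀ xs → List.concatMap (λ x → map (x ∷_) (allVecs k m)) xs ≡ cartesianProductWith _∷_ xs (allVecs k m)
  go []       = ≡.refl
  go (x ∷ xs) = ≡.cong (map (x ∷_) (allVecs k m) ++_) (go xs)

∈-allVecs : ∀ {k m} (v : Vec (Fin m) k) → v ∈ allVecs k m
∈-allVecs []                = here ≡.refl
∈-allVecs {suc k} {m} (x ∷ v) rewrite allVecs≡cartesianProduct k m =
  ∈-cartesianProductWith⁺ _∷_ (∈-allFin x) (∈-allVecs v)

allVecs-unique : ∀ k m → Unique (allVecs k m)
allVecs-unique zero    m = [] ∷ []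
allVecs-unique (suc k) m rewrite allVecs≡cartesianProduct k m =
  Uniqueₚ.cartesianProductWith⁺ _∷_ Vecₚ.∷-injective (Uniqueₚ.allFin⁺ m) (allVecs-unique k m)

𝔖-unique : ∀ n → Unique (𝔖 n)
𝔖-unique n = Uniqueₚ.filter⁺ _ (allVecs-unique n n)

∈-𝔖⁺ : ∀ {n} {π : Perm n} → IsPermutation π → π ∈ 𝔖 n
∈-𝔖⁺ {π = π} inj = ∈-filter⁺ (λ v → unique? Finₚ._≟_ (toList v)) (∈-allVecs π) (lookup-injective⇒Unique-toList π inj)

∈-𝔖⁻ : ∀ {n} {π : Perm n} → π ∈ 𝔖 n → IsPermutation π
∈-𝔖⁻ {n} {π} π∈𝔖 =
  Unique-toList⇒lookup-injective π (proj₂ (∈-filter⁻ (λ v → unique? Finₚ._≟_ (toList v)) {xs = allVecs n n} π∈𝔖))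

module _ {c ℓ : Level} (R : CommutativeSemiring c ℓ) where
  open CommutativeSemiring R hiding (zero)
  open FinSums R

  sumList-sameElements : ∀ {A : Set} (f : A → Carrier) {xs ys : List A} → Unique xs → Unique ys →
    (∀ {z} → z ∈ xs ⇔ z ∈ ys) → sumList R f xs ≈ sumList R f ys
  sumList-sameElements f ux uy xs≈ys = sumList-↭ R f (∼bag⇒↭ (unique∧set⇒bag ux uy xs≈ys))

  sum-reindex : ∀ {n} (π : Perm n) → IsPermutation π → (f : Fin n → Carrier) → sum f ≈ sum (f ∘ lookup π)
  sum-reindex π inj f = ∑-permute f (toPermutation π inj)

  sum-𝔖-suc : ∀ {m} (ins : Perm m → Fin (suc m) → Perm (suc m)) (rem : Perm (suc m) → Perm m × Fin (suc m)) →
    (∀ π k → rem (ins π k) ≡ (π , k)) →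
    (∀ π k → IsPermutation π → IsPermutation (ins π k)) →
    (∀ σ → IsPermutation σ → IsPermutation (proj₁ (rem σ)) × ins (proj₁ (rem σ)) (proj₂ (rem σ)) ≡ σ) →
    (G : Perm (suc m) → Carrier) →
    sumList R G (𝔖 (suc m)) ≈ sumList R (λ π → sum (λ k → G (ins π k))) (𝔖 m)
  sum-𝔖-suc {m} ins rem rem-ins ins-perm rem-perm G =
    trans (sumList-sameElements G (𝔖-unique (suc m)) unique (mk⇔ to from))
      (trans (sumList-cartesianProductWith R G ins (𝔖 m) (allFin (suc m)))
        (sumList-cong-∈ R (𝔖 m) (λ π _ → sumList-tabulate R (G ∘ ins π) id)))
    where
    unique : Unique (cartesianProductWith ins (𝔖 m) (allFin (suc m)))
    unique = Uniqueₚ.cartesianProductWith⁺ ins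
      (λ {π} {π′} {k} {k′} eq → ,-injective
        (≡.trans (≡.sym (rem-ins π k)) (≡.trans (≡.cong rem eq) (rem-ins π′ k′))))
      (𝔖-unique m) (Uniqueₚ.allFin⁺ (suc m))
    to : ∀ {σ} → σ ∈ 𝔖 (suc m) → σ ∈ cartesianProductWith ins (𝔖 m) (allFin (suc m))
    to {σ} σ∈𝔖 with rem-perm σ (∈-𝔖⁻ σ∈𝔖)
    ... | π-perm , ins-rem = ≡.subst (_∈ _) ins-rem (∈-cartesianProductWith⁺ ins (∈-𝔖⁺ π-perm) (∈-allFin _))
    from : ∀ {σ} → σ ∈ cartesianProductWith ins (𝔖 m) (allFin (suc m)) → σ ∈ 𝔖 (suc m)
    from σ∈ with π , k , π∈𝔖 , _ , ≡.refl ← ∈-cartesianProductWith⁻ ins (𝔖 m) (allFin (suc m)) σ∈ =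
      ∈-𝔖⁺ (ins-perm π k (∈-𝔖⁻ π∈𝔖))

-- Letter shapes and the insertion of a new maximum

data Shape : Set where
  peak valley dblAsc dblDes : Shape

shape : ℕ → ℕ → ℕ → Shape
shape a b c = if a <ᵇ b then (if c <ᵇ b then peak else dblAsc) else (if b <ᵇ c then valley else dblDes)

module _ {a b c : ℕ} where

  shape-peak : a < b → c < b → shape a b c ≡ peak
  shape-peak a<b c<b rewrite <ᵇ-true a<b | <ᵇ-true c<b = ≡.refl

  shape-dblAsc : a < b → b < c → shape a b c ≡ dblAsc
  shape-dblAsc a<b b<c rewrite <ᵇ-true a<b | <ᵇ-false (ℕₚ.<⇒≤ b<c) = ≡.refl

  shape-valley : b < a → b < c → shape a b c ≡ valley
  shape-valley b<a b<c rewrite <ᵇ-false (ℕₚ.<⇒≤ b<a) | <ᵇ-true b<c = ≡.refl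

  shape-dblDes : b < a → c < b → shape a b c ≡ dblDes
  shape-dblDes b<a c<b rewrite <ᵇ-false (ℕₚ.<⇒≤ b<a) | <ᵇ-false (ℕₚ.<⇒≤ c<b) = ≡.refl

shape-congˡ : ∀ {a a′ x r} → x < a → x < a′ → shape a x r ≡ shape a′ x r
shape-congˡ x<a x<a′ rewrite <ᵇ-false (ℕₚ.<⇒≤ x<a) | <ᵇ-false (ℕₚ.<⇒≤ x<a′) = ≡.refl

shape-congʳ : ∀ {l x r r′} → x < r → x < r′ → shape l x r ≡ shape l x r′
shape-congʳ x<r x<r′ rewrite <ᵇ-false (ℕₚ.<⇒≤ x<r) | <ᵇ-false (ℕₚ.<⇒≤ x<r′) | <ᵇ-true x<r | <ᵇ-true x<r′ = ≡.refl

letterBefore : ∀ {K} → ℕ → Vec ℕ K → Fin (suc K) → ℕ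
letterBefore l w       zero    = l
letterBefore l (x ∷ w) (suc k) = letterBefore x w k

-- The right neighbour of a letter followed by w, with π(n + 1) = 0 past the end of the word.
nextLetter : List ℕ → ℕ
nextLetter []      = 0
nextLetter (y ∷ _) = y

≢nextLetter : ∀ {x w} → 0 < x → Unique (x ∷ w) → x ≢ nextLetter w
≢nextLetter {w = []}    0<x _              = ℕₚ.<⇒≢ 0<x ∘ ≡.sym
≢nextLetter {w = _ ∷ _} _   ((x≢y ∷ _) ∷ _) = x≢y

module _ {c ℓ : Level} (R : CommutativeSemiring c ℓ) where
  open CommutativeSemiring R hiding (zero)

  -- l is the letter preceding w (π(0) = 0 at the start of a word).
  wordWeight : (ℕ → Shape → Carrier) → ℕ → List ℕ → Carrier
  wordWeight f l []      = 1#
  wordWeight f l (x ∷ w) = f x (shape l x (nextLetter w)) * wordWeight f x w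

  wordWeight-cong : ∀ {f g : ℕ → Shape → Carrier} l w → All (λ x → ∀ T → f x T ≈ g x T) w →
    wordWeight f l w ≈ wordWeight g l w
  wordWeight-cong l []      []            = refl
  wordWeight-cong l (x ∷ w) (f≈g ∷ w-f≈g) = *-cong (f≈g _) (wordWeight-cong x w w-f≈g)

module _ {c ℓ : Level} (R : CommutativeSemiring c ℓ) where
  open CommutativeSemiring R hiding (zero)

  wordWeight-primal : ∀ (f : ℕ → Shape → Carrier × Carrier) l w →
    proj₁ (wordWeight (dualNumbers R) f l w) ≡ wordWeight R (proj₁ ∘₂ f) l w
  wordWeight-primal f l []      = ≡.refl
  wordWeight-primal f l (x ∷ w) = ≡.cong (proj₁ (f x (shape l x (nextLetter w))) *_) (wordWeight-primal f x w)

-- Inserting a new maximal letter M = m + 1 into a word on 1, …, m.  The parameter s weights the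
-- simsun succession (m, M) created when M lands right after m.
module MaxInsertion {c ℓ : Level} (R : CommutativeSemiring c ℓ) (m : ℕ) (s : CommutativeSemiring.Carrier R)
                    (f : ℕ → Shape → CommutativeSemiring.Carrier R) where
  open CommutativeSemiring R hiding (zero)
  open FinSums R
  open NaturalSolver R
  open import Relation.Binary.Reasoning.Setoid setoid

  M : ℕ
  M = suc m

  W : ℕ → List ℕ → Carrier
  W = wordWeight R f

  weight : ℕ → ℕ → ℕ → Carrier
  weight l x r = f x (shape l x r)

  top : Carrier
  top = f M peak

  simsunFactor : ℕ → Carrier
  simsunFactor x = if x ≡ᵇ m then s else 1#

  simsunFactor-below : ∀ {x} → x < m → simsunFactor x ≈ 1#
  simsunFactor-below x<m rewrite ≡ᵇ-false (ℕₚ.<⇒≢ x<m) = refl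

  -- Inserting M into the gap between two letters changes the shape of the larger one only;
  -- the change is recorded (together with the weight of M) as a charge of that letter.
  chargeBefore chargeAfter tangent : ℕ → Shape → Carrier
  chargeBefore x peak   = top * f x dblDes
  chargeBefore x dblAsc = top * f x valley
  chargeBefore x _      = 0#
  chargeAfter x peak    = top * (simsunFactor x * f x dblAsc)
  chargeAfter x dblDes  = top * f x valley
  chargeAfter x _       = 0#
  tangent x T = chargeBefore x T + chargeAfter x T

  dualWeight : ℕ → Shape → Carrier × Carrier
  dualWeight x T = f x T , tangent x T

  dW : ℕ → List ℕ → Carrier
  dW l w = proj₂ (wordWeight (dualNumbers R) dualWeight l w)

  leadCharge tailTangent : ℕ → List ℕ → Carrier
  leadCharge l []      = 0#
  leadCharge l (x ∷ w) = chargeBefore x (shape l x (nextLetter w)) * W x w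
  tailTangent l []      = 0#
  tailTangent l (x ∷ w) = weight l x (nextLetter w) * dW x w + chargeAfter x (shape l x (nextLetter w)) * W x w

  dW-split : ∀ l w → dW l w ≈ leadCharge l w + tailTangent l w
  dW-split l []      = sym (+-identityˡ 0#)
  dW-split l (x ∷ w) = begin
    weight l x r * dW x w + tangent x S * proj₁ (wordWeight (dualNumbers R) dualWeight x w)
      ≈⟨ +-cong refl (*-cong refl (reflexive (wordWeight-primal R dualWeight x w))) ⟩
    weight l x r * dW x w + (chargeBefore x S + chargeAfter x S) * W x w
      ≈⟨ solve 5 (λ a d b c g → a :* d :+ (b :+ c) :* g := b :* g :+ (a :* d :+ c :* g)) refl _ _ _ _ _ ⟩
    leadCharge l (x ∷ w) + tailTangent l (x ∷ w) ∎
    where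
    r = nextLetter w
    S = shape l x r

  Admissible : ℕ → List ℕ → Set
  Admissible l w = l < M × All (λ x → 0 < x × x < M) w × Unique (l ∷ w)

  admissible-∷ : ∀ {l x w} → Admissible l (x ∷ w) → Admissible x w × l ≢ x × 0 < x
  admissible-∷ (l<M , (0<x , x<M) ∷ w-range , (l∉ ∷ x∉ ∷ u)) = (x<M , w-range , x∉ ∷ u) , All.head l∉ , 0<x

  chargeBefore-descent : ∀ {l x r} → x < l → chargeBefore x (shape l x r) ≡ 0#
  chargeBefore-descent {l} {x} {r} x<l rewrite <ᵇ-false (ℕₚ.<⇒≤ x<l) with x <ᵇ r
  ... | true  = ≡.refl
  ... | false = ≡.refl

  chargeAfter-ascent : ∀ {l x r} → x < r → chargeAfter x (shape l x r) ≡ 0#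
  chargeAfter-ascent {l} {x} {r} x<r rewrite <ᵇ-false (ℕₚ.<⇒≤ x<r) | <ᵇ-true x<r with l <ᵇ x
  ... | true  = ≡.refl
  ... | false = ≡.refl

  charge-before-top : ∀ {l y r} → l < y → y < M → y ≢ r → top * weight M y r ≈ chargeBefore y (shape l y r)
  charge-before-top {l} {y} {r} l<y y<M y≢r with ℕₚ.<-cmp y r
  ... | tri< y<r _ _ rewrite shape-valley y<M y<r | shape-dblAsc l<y y<r = refl
  ... | tri> _ _ r<y rewrite shape-dblDes y<M r<y | shape-peak l<y r<y = refl
  ... | tri≈ _ y≡r _ = ⊥-elim (y≢r y≡r)

  charge-after-top : ∀ {l x r} → l < M → x < M → l ≢ x → r < x →
    simsunFactor x * (weight l x M * top) ≈ chargeAfter x (shape l x r)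
  charge-after-top {l} {x} {r} l<M x<M l≢x r<x with ℕₚ.<-cmp l x
  ... | tri< l<x _ _ rewrite shape-dblAsc l<x x<M | shape-peak l<x r<x =
    solve 3 (λ a b t → a :* (b :* t) := t :* (a :* b)) refl _ _ _
  ... | tri> _ _ x<l rewrite shape-valley x<l x<M | shape-dblDes x<l r<x =
    trans (*-cong (simsunFactor-below (ℕₚ.<-≤-trans x<l (ℕₚ.≤-pred l<M))) (*-comm _ _)) (*-identityˡ _)
  ... | tri≈ _ l≡x _ = ⊥-elim (l≢x l≡x)

  weight-top : ∀ {x y} → x < M → y < M → weight x M y ≈ top
  weight-top x<M y<M = reflexive (≡.cong (f M) (shape-peak x<M y<M))

  insertAfter-weight : ∀ {l x} w → l < M → l ≢ x → 0 < x → Admissible x w →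
    simsunFactor x * W l (x ∷ M ∷ w) ≈
    chargeAfter x (shape l x (nextLetter w)) * W x w + weight l x (nextLetter w) * leadCharge x w
  insertAfter-weight {l} {x} [] l<M l≢x 0<x (x<M , _ , _) = begin
    simsunFactor x * (weight l x M * (weight x M 0 * 1#))
      ≈⟨ *-cong refl (*-cong refl (*-cong (weight-top x<M z<s) refl)) ⟩
    simsunFactor x * (weight l x M * (top * 1#))
      ≈⟨ solve 4 (λ a b t c → a :* (b :* (t :* con 1)) := (a :* (b :* t)) :* con 1 :+ c :* con 0) refl _ _ _ _ ⟩
    (simsunFactor x * (weight l x M * top)) * 1# + weight l x 0 * 0#
      ≈⟨ +-cong (*-cong (charge-after-top l<M x<M l≢x 0<x) refl) refl ⟩
    chargeAfter x (shape l x 0) * 1# + weight l x 0 * 0# ∎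
  insertAfter-weight {l} {x} (y ∷ w) l<M l≢x 0<x adm@(x<M , _ , ((x≢y ∷ _) ∷ _))
    with (y<M , w-range , y-unique) , _ , 0<y ← admissible-∷ adm
    with ℕₚ.<-cmp x y
  ... | tri< x<y _ _ = begin
    simsunFactor x * (weight l x M * (weight x M y * (weight M y r * W y w)))
      ≈⟨ *-cong (simsunFactor-below (ℕₚ.<-≤-trans x<y (ℕₚ.≤-pred y<M)))
                (*-cong (reflexive (≡.cong (f x) (shape-congʳ x<M x<y))) (*-cong (weight-top x<M y<M) refl)) ⟩
    1# * (weight l x y * (top * (weight M y r * W y w)))
      ≈⟨ solve 4 (λ a t b g → con 1 :* (a :* (t :* (b :* g))) := a :* ((t :* b) :* g)) refl _ _ _ _ ⟩
    weight l x y * ((top * weight M y r) * W y w)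
      ≈⟨ *-cong refl (*-cong (charge-before-top x<y y<M (≢nextLetter 0<y y-unique)) refl) ⟩
    weight l x y * leadCharge x (y ∷ w)
      ≈⟨ solve 2 (λ a g → a := con 0 :* g :+ a) refl _ (W x (y ∷ w)) ⟩
    0# * W x (y ∷ w) + weight l x y * leadCharge x (y ∷ w)
      ≈⟨ +-cong (*-cong (reflexive (≡.sym (chargeAfter-ascent x<y))) refl) refl ⟩
    chargeAfter x (shape l x y) * W x (y ∷ w) + weight l x y * leadCharge x (y ∷ w) ∎
    where r = nextLetter w
  ... | tri> _ _ y<x = begin
    simsunFactor x * (weight l x M * (weight x M y * (weight M y r * W y w)))
      ≈⟨ *-cong refl (*-cong refl (*-cong (weight-top x<M y<M) (*-cong (reflexive (≡.cong (f y) (shape-congˡ y<M y<x))) refl))) ⟩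
    simsunFactor x * (weight l x M * (top * (weight x y r * W y w)))
      ≈⟨ solve 6 (λ a b t c g e → a :* (b :* (t :* (c :* g))) := (a :* (b :* t)) :* (c :* g) :+ e :* (con 0 :* g)) refl
               _ _ _ _ _ (weight l x y) ⟩
    (simsunFactor x * (weight l x M * top)) * W x (y ∷ w) + weight l x y * (0# * W y w)
      ≈⟨ +-cong (*-cong (charge-after-top l<M x<M l≢x y<x) refl)
                (*-cong refl (*-cong (reflexive (≡.sym (chargeBefore-descent y<x))) refl)) ⟩
    chargeAfter x (shape l x y) * W x (y ∷ w) + weight l x y * leadCharge x (y ∷ w) ∎
    where r = nextLetter w
  ... | tri≈ _ x≡y _ = ⊥-elim (x≢y x≡y)

  insertion : ∀ {K} → ℕ → Vec ℕ K → Fin (suc K) → Carrier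
  insertion l w k = simsunFactor (letterBefore l w k) * W l (toList (Vec.insertAt w k M))

  insertions-behind : ∀ {K} l x (w : Vec ℕ K) →
    sum (λ j → insertion l (x ∷ w) (suc (suc j))) ≈ weight l x (nextLetter (toList w)) * sum (λ j → insertion x w (suc j))
  insertions-behind l x []      = sym (zeroʳ _)
  insertions-behind l x (y ∷ w) =
    trans (sum-cong-≋ {x = λ j → insertion l (x ∷ y ∷ w) (suc (suc j))} {y = λ j → weight l x y * insertion x (y ∷ w) (suc j)}
                      (λ j → solve 3 (λ a b g → a :* (b :* g) := b :* (a :* g)) refl _ _ _))
          (sym (*-distribˡ-sum (weight l x y) (λ j → insertion x (y ∷ w) (suc j))))

  tail-insertions : ∀ {K} l (w : Vec ℕ K) → Admissible l (toList w) →
    sum (λ j → insertion l w (suc j)) ≈ tailTangent l (toList w)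
  tail-insertions l []      _   = refl
  tail-insertions l (x ∷ w) adm@(l<M , _) with adm′ , l≢x , 0<x ← admissible-∷ adm = begin
    insertion l (x ∷ w) (suc zero) + sum (λ j → insertion l (x ∷ w) (suc (suc j)))
      ≈⟨ +-cong (insertAfter-weight (toList w) l<M l≢x 0<x adm′)
                (trans (insertions-behind l x w) (*-cong refl (tail-insertions x w adm′))) ⟩
    (chargeAfter x (shape l x r) * W x w′ + weight l x r * leadCharge x w′) + weight l x r * tailTangent x w′
      ≈⟨ solve 5 (λ c g a d t → (c :* g :+ a :* d) :+ a :* t := a :* (d :+ t) :+ c :* g) refl _ _ _ _ _ ⟩
    weight l x r * (leadCharge x w′ + tailTangent x w′) + chargeAfter x (shape l x r) * W x w′
      ≈⟨ +-cong (*-cong refl (sym (dW-split x w′))) refl ⟩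
    tailTangent l (x ∷ w′) ∎
    where
    w′ = toList w
    r = nextLetter w′

  insertions-derivative : ∀ {K} (w : Vec ℕ (suc K)) → 0 < m → Admissible 0 (toList w) →
    sum (insertion 0 w) ≈ dW 0 (toList w)
  insertions-derivative (x ∷ w) 0<m adm with (x<M , _ , x-unique) , _ , 0<x ← admissible-∷ adm = begin
    simsunFactor 0 * (weight 0 M x * (weight M x r * W x w′)) + sum (λ j → insertion 0 (x ∷ w) (suc j))
      ≈⟨ +-cong (*-cong (simsunFactor-below 0<m) (*-cong (reflexive (≡.cong (f M) (shape-peak z<s x<M))) refl))
                (tail-insertions 0 (x ∷ w) adm) ⟩
    1# * (top * (weight M x r * W x w′)) + tailTangent 0 (x ∷ w′)
      ≈⟨ +-cong (solve 3 (λ t b g → con 1 :* (t :* (b :* g)) := (t :* b) :* g) refl _ _ _) refl ⟩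
    (top * weight M x r) * W x w′ + tailTangent 0 (x ∷ w′)
      ≈⟨ +-cong (*-cong (charge-before-top 0<x x<M (≢nextLetter 0<x x-unique)) refl) refl ⟩
    leadCharge 0 (x ∷ w′) + tailTangent 0 (x ∷ w′)
      ≈⟨ sym (dW-split 0 (x ∷ w′)) ⟩
    dW 0 (x ∷ w′) ∎
    where
    w′ = toList w
    r = nextLetter w′

-- A new maximum M = m + 1 exceeds every a + 1 < M, so it breaks no simsun succession, and it
-- creates one, (m, M), exactly when it is placed right after m.
module _ {m : ℕ} where

  succAt-beyond : ∀ {a} w → m ≤ a → All (_< suc m) w → succAt a w ≡ false
  succAt-beyond []      _   _           = ≡.refl
  succAt-beyond (x ∷ w) m≤a (x<M ∷ _)
    rewrite ≡ᵇ-false (ℕₚ.<⇒≢ (ℕₚ.≤-trans x<M (s≤s m≤a))) | <ᵇ-false (ℕₚ.m≤n⇒m≤1+n (ℕₚ.≤-trans (ℕₚ.≤-pred x<M) m≤a)) = ≡.refl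

  succAt-insertMax : ∀ {K} {l} (w : Vec ℕ K) j → l < m →
    succAt l (toList (Vec.insertAt w j (suc m))) ≡ succAt l (toList w)
  succAt-insertMax w zero l<m rewrite ≡ᵇ-false (ℕₚ.<⇒≢ (s<s l<m) ∘ ≡.sym) | <ᵇ-true (s<s l<m) = ≡.refl
  succAt-insertMax {l = l} (y ∷ w) (suc j) l<m =
    ≡.cong (λ b → if y ≡ᵇ suc l then true else (if suc l <ᵇ y then b else false)) (succAt-insertMax w j l<m)

  simsucW-insertMax : ∀ {K} l (w : Vec ℕ K) j → l < suc m → All (_< suc m) (toList w) →
    simsucW (l ∷ toList (Vec.insertAt w j (suc m))) ≡ simsucW (l ∷ toList w) ℕ.+ indicator (letterBefore l w j ≡ᵇ m)
  simsucW-insertMax l w zero l<M w<M with ℕₚ.<-cmp l m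
  ... | tri≈ _ ≡.refl _
    rewrite ≡ᵇ-true l | succAt-beyond {a = suc l} (toList w) (ℕₚ.n≤1+n l) w<M | succAt-beyond {a = l} (toList w) ℕₚ.≤-refl w<M =
    ℕₚ.+-comm 1 (simsucW (toList w))
  ... | tri< l<m _ _
    rewrite ≡ᵇ-false (ℕₚ.<⇒≢ (s<s l<m) ∘ ≡.sym) | <ᵇ-true (s<s l<m) | succAt-beyond {a = suc m} (toList w) (ℕₚ.n≤1+n m) w<M
          | ≡ᵇ-false (ℕₚ.<⇒≢ l<m) = ≡.sym (ℕₚ.+-identityʳ _)
  ... | tri> _ _ m<l = ⊥-elim (ℕₚ.<⇒≱ l<M m<l)
  simsucW-insertMax l (x ∷ w) (suc j) l<M (x<M ∷ w<M) =
    ≡.trans (≡.cong₂ ℕ._+_ (≡.cong indicator first-letter) (simsucW-insertMax x w j x<M w<M))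
            (≡.sym (ℕₚ.+-assoc (indicator (succAt l (x ∷ toList w))) (simsucW (x ∷ toList w)) _))
    where
    first-letter : succAt l (x ∷ toList (Vec.insertAt w j (suc m))) ≡ succAt l (x ∷ toList w)
    first-letter with x ≡ᵇ suc l | suc l <ᵇ x in 1+l<ᵇx
    ... | true  | _     = ≡.refl
    ... | false | false = ≡.refl
    ... | false | true  =
      succAt-insertMax w j (ℕₚ.<⇒≤ (ℕₚ.<-≤-trans (ℕₚ.<ᵇ⇒< (suc l) x (Equivalence.from Boolₚ.T-≡ 1+l<ᵇx)) (ℕₚ.≤-pred x<M)))

  simsuc-insertMax : ∀ {K} (w : Vec ℕ K) k → 0 < m → All (_< suc m) (toList w) →
    simsucW (toList (Vec.insertAt w k (suc m))) ≡ simsucW (toList w) ℕ.+ indicator (letterBefore 0 w k ≡ᵇ m)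
  simsuc-insertMax w       zero    0<m w<M
    rewrite succAt-beyond {a = suc m} (toList w) (ℕₚ.n≤1+n m) w<M | ≡ᵇ-false (ℕₚ.<⇒≢ 0<m) = ≡.sym (ℕₚ.+-identityʳ _)
  simsuc-insertMax (x ∷ w) (suc k) 0<m (x<M ∷ w<M) = simsucW-insertMax x w k x<M w<M

-- The first position of y in σ, or zero if y does not occur.
positionOf : ∀ {n m} → Vec (Fin n) (suc m) → Fin n → Fin (suc m)
positionOf σ y with Finₚ.any? (λ i → lookup σ i Finₚ.≟ y)
... | yes (i , _) = i
... | no _        = zero

lookup-positionOf : ∀ {n m} (σ : Vec (Fin n) (suc m)) {y} → (∃ λ i → lookup σ i ≡ y) → lookup σ (positionOf σ y) ≡ y
lookup-positionOf σ {y} y∈σ with Finₚ.any? (λ i → lookup σ i Finₚ.≟ y)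
... | yes (_ , σi≡y) = σi≡y
... | no  y∉σ        = ⊥-elim (y∉σ y∈σ)

punchIn-view : ∀ {n} (i j : Fin (suc n)) → j ≡ i ⊎ ∃ λ j′ → j ≡ punchIn i j′
punchIn-view i j with j Finₚ.≟ i
... | yes j≡i = inj₁ j≡i
... | no  j≢i = inj₂ (punchOut (j≢i ∘ ≡.sym) , ≡.sym (Finₚ.punchIn-punchOut _))

lookup-removeAt : ∀ {A : Set} {n} (xs : Vec A (suc n)) i j → lookup (Vec.removeAt xs i) j ≡ lookup xs (punchIn i j)
lookup-removeAt (x ∷ xs)     zero    j       = ≡.refl
lookup-removeAt (x ∷ y ∷ xs) (suc i) zero    = ≡.refl
lookup-removeAt (x ∷ y ∷ xs) (suc i) (suc j) = lookup-removeAt (y ∷ xs) i j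

pinch-inject₁ : ∀ {n} (j : Fin (suc n)) → Fin.pinch (fromℕ n) (inject₁ j) ≡ j
pinch-inject₁ {zero}  zero    = ≡.refl
pinch-inject₁ {suc n} zero    = ≡.refl
pinch-inject₁ {suc n} (suc j) = ≡.cong suc (pinch-inject₁ j)

inject₁-pinch : ∀ {n} (x : Fin (suc (suc n))) → x ≢ fromℕ (suc n) → inject₁ (Fin.pinch (fromℕ n) x) ≡ x
inject₁-pinch         zero          _   = ≡.refl
inject₁-pinch {zero}  (suc zero)    x≢1 = ⊥-elim (x≢1 ≡.refl)
inject₁-pinch {suc n} (suc x)       x≢n = ≡.cong suc (inject₁-pinch x (x≢n ∘ ≡.cong suc))

-- Inverse of Vec.map inject₁ on vectors avoiding the top value fromℕ m.
lowerAll : ∀ {m} → Vec (Fin (suc m)) m → Vec (Fin m) m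
lowerAll {zero}  []    = []
lowerAll {suc m} v     = Vec.map (Fin.pinch (fromℕ m)) v

lowerAll-inject₁ : ∀ {m} (π : Vec (Fin m) m) → lowerAll (Vec.map inject₁ π) ≡ π
lowerAll-inject₁ {zero}  []    = ≡.refl
lowerAll-inject₁ {suc m} π     =
  ≡.trans (≡.sym (Vecₚ.map-∘ _ inject₁ π)) (≡.trans (Vecₚ.map-cong pinch-inject₁ π) (Vecₚ.map-id π))

inject₁-lowerAll : ∀ {m} (v : Vec (Fin (suc m)) m) → (∀ j → lookup v j ≢ fromℕ m) → Vec.map inject₁ (lowerAll v) ≡ v
inject₁-lowerAll {zero}  []    _    = ≡.refl
inject₁-lowerAll {suc m} v     v≢top =
  ≡.trans (≡.sym (Vecₚ.map-∘ inject₁ _ v)) (≡.trans (go v v≢top) (Vecₚ.map-id v))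
  where
  go : ∀ {k} (u : Vec (Fin (suc (suc m))) k) → (∀ j → lookup u j ≢ fromℕ (suc m)) →
    Vec.map (inject₁ ∘ Fin.pinch (fromℕ m)) u ≡ Vec.map id u
  go []      _     = ≡.refl
  go (x ∷ u) u≢top = ≡.cong₂ _∷_ (inject₁-pinch x (u≢top zero)) (go u (u≢top ∘ suc))

insertMax : ∀ {m} → Perm m → Fin (suc m) → Perm (suc m)
insertMax {m} π k = Vec.insertAt (Vec.map inject₁ π) k (fromℕ m)

removeMax : ∀ {m} → Perm (suc m) → Perm m × Fin (suc m)
removeMax {m} σ = lowerAll (Vec.removeAt σ k) , k
  where k = positionOf σ (fromℕ m)

lookup-insertMax-new : ∀ {m} (π : Perm m) k → lookup (insertMax π k) k ≡ fromℕ m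
lookup-insertMax-new π k = Vecₚ.insertAt-lookup (Vec.map inject₁ π) k _

lookup-insertMax-old : ∀ {m} (π : Perm m) k j → lookup (insertMax π k) (punchIn k j) ≡ inject₁ (lookup π j)
lookup-insertMax-old π k j = ≡.trans (Vecₚ.insertAt-punchIn (Vec.map inject₁ π) k _ j) (Vecₚ.lookup-map j inject₁ π)

insertMax-permutation : ∀ {m} (π : Perm m) k → IsPermutation π → IsPermutation (insertMax π k)
insertMax-permutation π k inj {i} {j} eq with punchIn-view k i | punchIn-view k j
... | inj₁ ≡.refl         | inj₁ ≡.refl         = ≡.refl
... | inj₁ ≡.refl         | inj₂ (j′ , ≡.refl) =
  ⊥-elim (Finₚ.fromℕ≢inject₁ (≡.trans (≡.sym (lookup-insertMax-new π k)) (≡.trans eq (lookup-insertMax-old π k j′))))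
... | inj₂ (i′ , ≡.refl) | inj₁ ≡.refl         =
  ⊥-elim (Finₚ.fromℕ≢inject₁ (≡.trans (≡.sym (lookup-insertMax-new π k)) (≡.trans (≡.sym eq) (lookup-insertMax-old π k i′))))
... | inj₂ (i′ , ≡.refl) | inj₂ (j′ , ≡.refl) =
  ≡.cong (punchIn k) (inj (Finₚ.inject₁-injective
    (≡.trans (≡.sym (lookup-insertMax-old π k i′)) (≡.trans eq (lookup-insertMax-old π k j′)))))

removeMax-insertMax : ∀ {m} (π : Perm m) k → removeMax (insertMax π k) ≡ (π , k)
removeMax-insertMax {m} π k with punchIn-view k (positionOf (insertMax π k) (fromℕ m))
... | inj₁ p≡k = ≡.cong₂ _,_
  (≡.trans (≡.cong (lowerAll ∘ Vec.removeAt (insertMax π k)) p≡k)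
    (≡.trans (≡.cong lowerAll (Vecₚ.removeAt-insertAt (Vec.map inject₁ π) k _)) (lowerAll-inject₁ π)))
  p≡k
... | inj₂ (j′ , p≡k↑j′) = ⊥-elim (Finₚ.fromℕ≢inject₁ (≡.trans (≡.sym top-at-p)
        (≡.trans (≡.cong (lookup (insertMax π k)) p≡k↑j′) (lookup-insertMax-old π k j′))))
  where
  top-at-p : lookup (insertMax π k) (positionOf (insertMax π k) (fromℕ m)) ≡ fromℕ m
  top-at-p = lookup-positionOf (insertMax π k) (k , lookup-insertMax-new π k)

insertMax-removeMax : ∀ {m} (σ : Perm (suc m)) → IsPermutation σ →
  IsPermutation (proj₁ (removeMax σ)) × insertMax (proj₁ (removeMax σ)) (proj₂ (removeMax σ)) ≡ σ
insertMax-removeMax {m} σ inj = π-permutation , insertMax-π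
  where
  k = positionOf σ (fromℕ m)
  σk≡top : lookup σ k ≡ fromℕ m
  σk≡top = lookup-positionOf σ (IsPermutation⇒surjective σ inj (fromℕ m))
  rest = Vec.removeAt σ k
  rest≢top : ∀ j → lookup rest j ≢ fromℕ m
  rest≢top j eq = Finₚ.punchInᵢ≢i k j (inj (≡.trans (≡.sym (lookup-removeAt σ k j)) (≡.trans eq (≡.sym σk≡top))))
  lowered = inject₁-lowerAll rest rest≢top
  insertMax-π : insertMax (lowerAll rest) k ≡ σ
  insertMax-π = ≡.trans (≡.cong (λ u → Vec.insertAt u k (fromℕ m)) lowered)
                  (≡.trans (≡.cong (Vec.insertAt rest k) (≡.sym σk≡top)) (Vecₚ.insertAt-removeAt σ k))
  lookup-lowered : ∀ i → inject₁ (lookup (lowerAll rest) i) ≡ lookup σ (punchIn k i)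
  lookup-lowered i = ≡.trans (≡.sym (Vecₚ.lookup-map i inject₁ (lowerAll rest)))
                       (≡.trans (≡.cong (λ u → lookup u i) lowered) (lookup-removeAt σ k i))
  π-permutation : IsPermutation (lowerAll rest)
  π-permutation {i} {j} eq = Finₚ.punchIn-injective k i j
    (inj (≡.trans (≡.sym (lookup-lowered i)) (≡.trans (≡.cong inject₁ eq) (lookup-lowered j))))

-- The recursion for A

module _ {c ℓ : Level} (R : CommutativeSemiring c ℓ) where
  open CommutativeSemiring R hiding (zero)
  open NaturalSolver R

  topMarkedWeight : ℕ → (α₁ α₂ α₃ α₄ ω : Carrier) → ℕ → Shape → Carrier
  topMarkedWeight t α₁ α₂ α₃ α₄ ω x peak   = if x ≡ᵇ t then ω else α₁
  topMarkedWeight t α₁ α₂ α₃ α₄ ω x valley = α₂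
  topMarkedWeight t α₁ α₂ α₃ α₄ ω x dblAsc = α₃
  topMarkedWeight t α₁ α₂ α₃ α₄ ω x dblDes = α₄

  -- A_{n+1}(α₁, α₂, α₃, α₄, 0) with the peak at the maximal letter n + 1 weighted ω.
  Atop : ℕ → (α₁ α₂ α₃ α₄ ω : Carrier) → Carrier
  Atop n α₁ α₂ α₃ α₄ ω = sumList R
    (λ π → pow R 0# (simsuc π) * wordWeight R (topMarkedWeight (suc n) α₁ α₂ α₃ α₄ ω) 0 (word π)) (𝔖 (suc n))

  Atop-zero : ∀ α₁ α₂ α₃ α₄ ω → Atop 0 α₁ α₂ α₃ α₄ ω ≈ ω
  Atop-zero α₁ α₂ α₃ α₄ ω = solve 1 (λ ω → con 1 :* (ω :* con 1) :+ con 0 := ω) refl ω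

module _ {c ℓ : Level} (R : CommutativeSemiring c ℓ) where
  open CommutativeSemiring R hiding (zero)

  pow-scalar : ∀ a k → CommutativeSemiring._≈_ (dualNumbers R) (pow (dualNumbers R) (a , 0#) k) (pow R a k , 0#)
  pow-scalar a zero    = refl , refl
  pow-scalar a (suc k) with p≈ , p′≈0 ← pow-scalar a k =
    *-cong refl p≈ , trans (+-cong (*-cong refl p′≈0) (zeroˡ _)) (trans (+-identityʳ _) (zeroʳ a))

letters : ∀ {n} → Perm n → Vec ℕ n
letters = Vec.map (suc ∘ toℕ)

word≡letters : ∀ {n} (π : Perm n) → word π ≡ toList (letters π)
word≡letters π = ≡.sym (Vecₚ.toList-map (suc ∘ toℕ) π)

letters-insertMax : ∀ {m} (π : Perm m) k → letters (insertMax π k) ≡ Vec.insertAt (letters π) k (suc m)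
letters-insertMax {m} π k = ≡.trans (Vecₚ.map-insertAt (suc ∘ toℕ) (fromℕ m) (Vec.map inject₁ π) k)
  (≡.cong₂ (λ u v → Vec.insertAt u k v)
    (≡.trans (≡.sym (Vecₚ.map-∘ (suc ∘ toℕ) inject₁ π)) (Vecₚ.map-cong (≡.cong suc ∘ Finₚ.toℕ-inject₁) π))
    (≡.cong suc (Finₚ.toℕ-fromℕ m)))

letters-range : ∀ {n} (π : Perm n) → All (λ b → 0 < b × b < suc n) (toList (letters π))
letters-range {n} = go
  where
  go : ∀ {k} (v : Vec (Fin n) k) → All (λ b → 0 < b × b < suc n) (toList (Vec.map (suc ∘ toℕ) v))
  go []      = []
  go (x ∷ v) = (z<s , s<s (Finₚ.toℕ<n x)) ∷ go v

letters-unique : ∀ {n} (π : Perm n) → IsPermutation π → Unique (0 ∷ toList (letters π))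
letters-unique π inj =
  All.map (λ (0<b , _) → ℕₚ.<⇒≢ 0<b) (letters-range π)
  ∷ lookup-injective⇒Unique-toList (letters π)
      (λ {i} {j} eq → inj (Finₚ.toℕ-injective (ℕₚ.suc-injective
        (≡.trans (≡.sym (Vecₚ.lookup-map i (suc ∘ toℕ) π)) (≡.trans eq (Vecₚ.lookup-map j (suc ∘ toℕ) π))))))

module _ {c ℓ : Level} (R : CommutativeSemiring c ℓ) (n : ℕ) (α₁ α₂ α₃ α₄ ω : CommutativeSemiring.Carrier R) where
  open CommutativeSemiring R hiding (zero)
  open FinSums R
  open NaturalSolver R
  open import Relation.Binary.Reasoning.Setoid setoid
  private
    module D = CommutativeSemiring (dualNumbers R)
    f₂ = topMarkedWeight R (suc (suc n)) α₁ α₂ α₃ α₄ ω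
    f′ = topMarkedWeight (dualNumbers R) (suc n) (α₁ , ω * (α₃ + α₄)) (α₂ , 0#) (α₃ , ω * α₂) (α₄ , ω * α₂) (α₁ , ω * α₄)
  open MaxInsertion R (suc n) 0# f₂

  private
    top≡ω : top ≡ ω
    top≡ω = ≡.cong (λ b → if b then ω else α₁) (≡ᵇ-true (suc (suc n)))

    dualWeight≈ : ∀ b → b < M → ∀ S → dualWeight b S D.≈ f′ b S
    dualWeight≈ b b<M peak rewrite top≡ω | ≡ᵇ-false (ℕₚ.<⇒≢ b<M) with b ≡ᵇ suc n
    ... | true  = refl , solve 3 (λ ω a₃ a₄ → ω :* a₄ :+ ω :* (con 0 :* a₃) := ω :* a₄) refl ω α₃ α₄
    ... | false = refl , solve 3 (λ ω a₃ a₄ → ω :* a₄ :+ ω :* (con 1 :* a₃) := ω :* (a₃ :+ a₄)) refl ω α₃ α₄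
    dualWeight≈ b b<M valley = refl , +-identityʳ 0#
    dualWeight≈ b b<M dblAsc rewrite top≡ω = refl , +-identityʳ _
    dualWeight≈ b b<M dblDes rewrite top≡ω = refl , +-identityˡ _

    insertMax-weights : ∀ π → IsPermutation π →
      sum (λ k → pow R 0# (simsuc (insertMax π k)) * W 0 (word (insertMax π k))) ≈
      pow R 0# (simsuc π) * proj₂ (wordWeight (dualNumbers R) f′ 0 (word π))
    insertMax-weights π inj = begin
      sum (λ k → pow R 0# (simsuc (insertMax π k)) * W 0 (word (insertMax π k)))
        ≈⟨ sum-cong-≋ {x = λ k → pow R 0# (simsuc (insertMax π k)) * W 0 (word (insertMax π k))}
                      {y = λ k → pow R 0# (simsucW w′) * insertion 0 w k} at-position ⟩
      sum (λ k → pow R 0# (simsucW w′) * insertion 0 w k)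
        ≈⟨ sym (*-distribˡ-sum (pow R 0# (simsucW w′)) (insertion 0 w)) ⟩
      pow R 0# (simsucW w′) * sum (insertion 0 w)
        ≈⟨ *-cong refl (insertions-derivative w z<s (z<s , letters-range π , letters-unique π inj)) ⟩
      pow R 0# (simsucW w′) * dW 0 w′
        ≈⟨ *-cong refl (proj₂ (wordWeight-cong (dualNumbers R) 0 w′ (All.map (λ (_ , b<M) → dualWeight≈ _ b<M) (letters-range π)))) ⟩
      pow R 0# (simsucW w′) * proj₂ (wordWeight (dualNumbers R) f′ 0 w′)
        ≡⟨ ≡.cong (λ u → pow R 0# (simsucW u) * proj₂ (wordWeight (dualNumbers R) f′ 0 u)) (≡.sym (word≡letters π)) ⟩
      pow R 0# (simsuc π) * proj₂ (wordWeight (dualNumbers R) f′ 0 (word π)) ∎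
      where
      w = letters π
      w′ = toList w
      at-position : ∀ k → pow R 0# (simsuc (insertMax π k)) * W 0 (word (insertMax π k)) ≈ pow R 0# (simsucW w′) * insertion 0 w k
      at-position k = begin
        pow R 0# (simsuc (insertMax π k)) * W 0 (word (insertMax π k))
          ≡⟨ ≡.cong (λ u → pow R 0# (simsucW u) * W 0 u) (≡.trans (word≡letters (insertMax π k)) (≡.cong toList (letters-insertMax π k))) ⟩
        pow R 0# (simsucW (toList (Vec.insertAt w k M))) * W 0 (toList (Vec.insertAt w k M))
          ≡⟨ ≡.cong (λ e → pow R 0# e * W 0 (toList (Vec.insertAt w k M))) (simsuc-insertMax w k z<s (All.map proj₂ (letters-range π))) ⟩
        pow R 0# (simsucW w′ ℕ.+ indicator (letterBefore 0 w k ≡ᵇ suc n)) * W 0 (toList (Vec.insertAt w k M))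
          ≈⟨ *-cong (trans (pow-+ R 0# (simsucW w′) _) (*-cong refl (pow-indicator R 0# _))) refl ⟩
        (pow R 0# (simsucW w′) * simsunFactor (letterBefore 0 w k)) * W 0 (toList (Vec.insertAt w k M))
          ≈⟨ *-assoc _ _ _ ⟩
        pow R 0# (simsucW w′) * insertion 0 w k ∎

  Atop-suc : Atop R (suc n) α₁ α₂ α₃ α₄ ω ≈
    proj₂ (Atop (dualNumbers R) n (α₁ , ω * (α₃ + α₄)) (α₂ , 0#) (α₃ , ω * α₂) (α₄ , ω * α₂) (α₁ , ω * α₄))
  Atop-suc = begin
    sumList R (λ σ → pow R 0# (simsuc σ) * W 0 (word σ)) (𝔖 (suc (suc n)))
      ≈⟨ sum-𝔖-suc R {suc n} insertMax removeMax removeMax-insertMax insertMax-permutation insertMax-removeMax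
           (λ σ → pow R 0# (simsuc σ) * W 0 (word σ)) ⟩
    sumList R (λ π → sum (λ k → pow R 0# (simsuc (insertMax π k)) * W 0 (word (insertMax π k)))) (𝔖 (suc n))
      ≈⟨ sumList-cong-∈ R (𝔖 (suc n)) (λ π π∈𝔖 → insertMax-weights π (∈-𝔖⁻ π∈𝔖)) ⟩
    sumList R (λ π → pow R 0# (simsuc π) * proj₂ (wordWeight (dualNumbers R) f′ 0 (word π))) (𝔖 (suc n))
      ≈⟨ sumList-cong-∈ R (𝔖 (suc n)) (λ π _ → scalar-tangent (simsuc π) (wordWeight (dualNumbers R) f′ 0 (word π))) ⟨
    sumList R (λ π → proj₂ (pow (dualNumbers R) (0# , 0#) (simsuc π) D.* wordWeight (dualNumbers R) f′ 0 (word π))) (𝔖 (suc n))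
      ≈⟨ sumList-tangent R _ (𝔖 (suc n)) ⟨
    proj₂ (Atop (dualNumbers R) n (α₁ , ω * (α₃ + α₄)) (α₂ , 0#) (α₃ , ω * α₂) (α₄ , ω * α₂) (α₁ , ω * α₄)) ∎
    where
    scalar-tangent : ∀ k X → proj₂ (pow (dualNumbers R) (0# , 0#) k D.* X) ≈ pow R 0# k * proj₂ X
    scalar-tangent k (x , x′) with p≈ , p′≈0 ← pow-scalar R 0# k =
      trans (+-cong (*-cong p≈ refl) (*-cong p′≈0 refl)) (trans (+-cong refl (zeroˡ x)) (+-identityʳ _))

pkᵇ valᵇ dascᵇ ddesᵇ : ℕ → ℕ → ℕ → Bool
pkᵇ   a b c = (a <ᵇ b) ∧ (c <ᵇ b)
valᵇ  a b c = (b <ᵇ a) ∧ (b <ᵇ c)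
dascᵇ a b c = (a <ᵇ b) ∧ (b <ᵇ c)
ddesᵇ a b c = (b <ᵇ a) ∧ (c <ᵇ b)

countTriples-∷ : ∀ p l x w →
  countTriples p (l ∷ x ∷ w ++ 0 ∷ []) ≡ indicator (p l x (nextLetter w)) ℕ.+ countTriples p (x ∷ w ++ 0 ∷ [])
countTriples-∷ p l x []      = ≡.refl
countTriples-∷ p l x (_ ∷ _) = ≡.refl

module _ {c ℓ : Level} (R : CommutativeSemiring c ℓ) (t : ℕ) (α₁ α₂ α₃ α₄ : CommutativeSemiring.Carrier R) where
  open CommutativeSemiring R hiding (zero)
  open NaturalSolver R
  open import Relation.Binary.Reasoning.Setoid setoid
  private
    f = topMarkedWeight R t α₁ α₂ α₃ α₄ α₁
    letterWeight : ℕ → ℕ → ℕ → Carrier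
    letterWeight l x r = pow R α₁ (indicator (pkᵇ l x r)) * pow R α₂ (indicator (valᵇ l x r))
                       * pow R α₃ (indicator (dascᵇ l x r)) * pow R α₄ (indicator (ddesᵇ l x r))

  statisticWeight : ℕ → List ℕ → Carrier
  statisticWeight l w = pow R α₁ (countTriples pkᵇ p) * pow R α₂ (countTriples valᵇ p)
                      * pow R α₃ (countTriples dascᵇ p) * pow R α₄ (countTriples ddesᵇ p)
    where p = l ∷ w ++ 0 ∷ []

  private
    letterWeight≈ : ∀ l x r → l ≢ x → x ≢ r → letterWeight l x r ≈ f x (shape l x r)
    letterWeight≈ l x r l≢x x≢r with ℕₚ.<-cmp l x | ℕₚ.<-cmp x r
    ... | tri≈ _ l≡x _ | _            = ⊥-elim (l≢x l≡x)
    ... | _            | tri≈ _ x≡r _ = ⊥-elim (x≢r x≡r)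
    ... | tri< l<x _ _ | tri> _ _ r<x
      rewrite <ᵇ-true l<x | <ᵇ-true r<x | <ᵇ-false (ℕₚ.<⇒≤ l<x) | <ᵇ-false (ℕₚ.<⇒≤ r<x) with x ≡ᵇ t
    ... | true  = solve 1 (λ a → a :* con 1 :* con 1 :* con 1 :* con 1 := a) refl α₁
    ... | false = solve 1 (λ a → a :* con 1 :* con 1 :* con 1 :* con 1 := a) refl α₁
    letterWeight≈ l x r l≢x x≢r | tri< l<x _ _ | tri< x<r _ _
      rewrite <ᵇ-true l<x | <ᵇ-true x<r | <ᵇ-false (ℕₚ.<⇒≤ l<x) | <ᵇ-false (ℕₚ.<⇒≤ x<r) =
      solve 1 (λ a → con 1 :* con 1 :* (a :* con 1) :* con 1 := a) refl α₃
    letterWeight≈ l x r l≢x x≢r | tri> _ _ x<l | tri< x<r _ _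
      rewrite <ᵇ-true x<l | <ᵇ-true x<r | <ᵇ-false (ℕₚ.<⇒≤ x<l) | <ᵇ-false (ℕₚ.<⇒≤ x<r) =
      solve 1 (λ a → con 1 :* (a :* con 1) :* con 1 :* con 1 := a) refl α₂
    letterWeight≈ l x r l≢x x≢r | tri> _ _ x<l | tri> _ _ r<x
      rewrite <ᵇ-true x<l | <ᵇ-true r<x | <ᵇ-false (ℕₚ.<⇒≤ x<l) | <ᵇ-false (ℕₚ.<⇒≤ r<x) =
      solve 1 (λ a → con 1 :* con 1 :* con 1 :* (a :* con 1) := a) refl α₄

  statisticWeight≈wordWeight : ∀ l w → All (0 <_) w → Unique (l ∷ w) → statisticWeight l w ≈ wordWeight R f l w
  statisticWeight≈wordWeight l []      _            _                 = solve 0 (con 1 :* con 1 :* con 1 :* con 1 := con 1) refl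
  statisticWeight≈wordWeight l (x ∷ w) (0<x ∷ w-pos) ((l≢x ∷ _) ∷ x-unique) = begin
    statisticWeight l (x ∷ w)
      ≡⟨ ≡.cong₂ _*_ (≡.cong₂ _*_ (≡.cong₂ _*_ (≡.cong (pow R α₁) (countTriples-∷ pkᵇ l x w))
                                              (≡.cong (pow R α₂) (countTriples-∷ valᵇ l x w)))
                                  (≡.cong (pow R α₃) (countTriples-∷ dascᵇ l x w))) (≡.cong (pow R α₄) (countTriples-∷ ddesᵇ l x w)) ⟩
    pow R α₁ (i₁ ℕ.+ c₁) * pow R α₂ (i₂ ℕ.+ c₂) * pow R α₃ (i₃ ℕ.+ c₃) * pow R α₄ (i₄ ℕ.+ c₄)
      ≈⟨ *-cong (*-cong (*-cong (pow-+ R α₁ i₁ c₁) (pow-+ R α₂ i₂ c₂)) (pow-+ R α₃ i₃ c₃)) (pow-+ R α₄ i₄ c₄) ⟩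
    (pow R α₁ i₁ * pow R α₁ c₁) * (pow R α₂ i₂ * pow R α₂ c₂) * (pow R α₃ i₃ * pow R α₃ c₃) * (pow R α₄ i₄ * pow R α₄ c₄)
      ≈⟨ solve 8 (λ a b c d e f g h → (a :* b) :* (c :* d) :* (e :* f) :* (g :* h) := (a :* c :* e :* g) :* (b :* d :* f :* h))
               refl _ _ _ _ _ _ _ _ ⟩
    letterWeight l x r * statisticWeight x w
      ≈⟨ *-cong (letterWeight≈ l x r l≢x (≢nextLetter 0<x x-unique)) (statisticWeight≈wordWeight x w w-pos x-unique) ⟩
    wordWeight R f l (x ∷ w) ∎
    where
    r = nextLetter w
    i₁ = indicator (pkᵇ l x r)
    i₂ = indicator (valᵇ l x r)
    i₃ = indicator (dascᵇ l x r)
    i₄ = indicator (ddesᵇ l x r)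
    c₁ = countTriples pkᵇ (x ∷ w ++ 0 ∷ [])
    c₂ = countTriples valᵇ (x ∷ w ++ 0 ∷ [])
    c₃ = countTriples dascᵇ (x ∷ w ++ 0 ∷ [])
    c₄ = countTriples ddesᵇ (x ∷ w ++ 0 ∷ [])

A≈Atop : ∀ {c ℓ} (R : CommutativeSemiring c ℓ) n α₁ α₂ α₃ α₄ →
  CommutativeSemiring._≈_ R (A R (suc n) α₁ α₂ α₃ α₄ (CommutativeSemiring.0# R)) (Atop R n α₁ α₂ α₃ α₄ α₁)
A≈Atop R n α₁ α₂ α₃ α₄ = sumList-cong-∈ R (𝔖 (suc n)) (λ π π∈𝔖 →
  trans (*-comm _ _) (*-cong refl (statisticWeight≈wordWeight R (suc n) α₁ α₂ α₃ α₄ 0 (word π)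
    (≡.subst (All (0 <_)) (≡.sym (word≡letters π)) (All.map proj₁ (letters-range π)))
    (≡.subst (λ w → Unique (0 ∷ w)) (≡.sym (word≡letters π)) (letters-unique π (∈-𝔖⁻ π∈𝔖))))))
  where open CommutativeSemiring R hiding (zero)

-- Cycle shapes and the insertion of a new minimum

Vec-ext : ∀ {A : Set} {n} (u v : Vec A n) → (∀ i → lookup u i ≡ lookup v i) → u ≡ v
Vec-ext u v u≗v = ≡.trans (≡.sym (Vecₚ.tabulate∘lookup u)) (≡.trans (Vecₚ.tabulate-cong u≗v) (Vecₚ.tabulate∘lookup v))

-- Inverse of Vec.map suc on vectors avoiding zero.
predAll : ∀ {n} → Vec (Fin (suc n)) n → Vec (Fin n) n
predAll {zero}  []    = []
predAll {suc n} v     = Vec.map (Fin.pinch zero) v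

predAll-suc : ∀ {n} (π : Perm n) → predAll (Vec.map suc π) ≡ π
predAll-suc {zero}  []    = ≡.refl
predAll-suc {suc n} π     = ≡.trans (≡.sym (Vecₚ.map-∘ (Fin.pinch zero) suc π)) (Vecₚ.map-id π)

suc-predAll : ∀ {n} (v : Vec (Fin (suc n)) n) → (∀ j → lookup v j ≢ zero) → Vec.map suc (predAll v) ≡ v
suc-predAll {zero}  []    _    = ≡.refl
suc-predAll {suc n} v     v≢0 = Vec-ext _ _ λ j →
  ≡.trans (Vecₚ.lookup-map j suc (predAll v)) (≡.trans (≡.cong suc (Vecₚ.lookup-map j (Fin.pinch zero) v)) (suc-pinch (lookup v j) (v≢0 j)))
  where
  suc-pinch : ∀ (x : Fin (suc (suc n))) → x ≢ zero → suc (Fin.pinch zero x) ≡ x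
  suc-pinch zero    x≢0 = ⊥-elim (x≢0 ≡.refl)
  suc-pinch (suc x) _   = ≡.refl

-- Adding a new minimal element 0 to a permutation of {1, …, n}: as a fixed point (k = zero), or
-- inside the cycle of a, right after a (k = suc a).
insertMin : ∀ {n} → Perm n → Fin (suc n) → Perm (suc n)
insertMin π zero    = zero ∷ Vec.map suc π
insertMin π (suc a) = suc (lookup π a) ∷ (Vec.map suc π Vec.[ a ]≔ zero)

removeMin : ∀ {n} → Perm (suc n) → Perm n × Fin (suc n)
removeMin (zero ∷ rest)          = predAll rest , zero
removeMin {suc n} (suc c ∷ rest) = predAll (rest Vec.[ a ]≔ suc c) , suc a
  where a = positionOf rest zero

lookup-insertMin-fixed : ∀ {n} (π : Perm n) b → lookup (insertMin π zero) (suc b) ≡ suc (lookup π b)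
lookup-insertMin-fixed π b = Vecₚ.lookup-map b suc π

lookup-insertMin-new : ∀ {n} (π : Perm n) a → lookup (insertMin π (suc a)) (suc a) ≡ zero
lookup-insertMin-new π a = Vecₚ.lookup∘updateAt a (Vec.map suc π)

lookup-insertMin-old : ∀ {n} (π : Perm n) a b → b ≢ a → lookup (insertMin π (suc a)) (suc b) ≡ suc (lookup π b)
lookup-insertMin-old π a b b≢a = ≡.trans (Vecₚ.lookup∘updateAt′ b a b≢a (Vec.map suc π)) (Vecₚ.lookup-map b suc π)

sourceOf : ∀ {n} → Fin n → Fin (suc n) → Fin n
sourceOf a zero    = a
sourceOf a (suc b) = b

lookup-insertMin-source : ∀ {n} (π : Perm n) a i → i ≢ suc a → lookup (insertMin π (suc a)) i ≡ suc (lookup π (sourceOf a i))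
lookup-insertMin-source π a zero    _   = ≡.refl
lookup-insertMin-source π a (suc b) b≢a = lookup-insertMin-old π a b (b≢a ∘ ≡.cong suc)

sourceOf-injective : ∀ {n} (a : Fin n) {i j} → i ≢ suc a → j ≢ suc a → sourceOf a i ≡ sourceOf a j → i ≡ j
sourceOf-injective a {zero}  {zero}  _   _   _   = ≡.refl
sourceOf-injective a {zero}  {suc j} _   j≢a a≡j = ⊥-elim (j≢a (≡.cong suc (≡.sym a≡j)))
sourceOf-injective a {suc i} {zero}  i≢a _   i≡a = ⊥-elim (i≢a (≡.cong suc i≡a))
sourceOf-injective a {suc i} {suc j} _   _   i≡j = ≡.cong suc i≡j

insertMin-permutation : ∀ {n} (π : Perm n) k → IsPermutation π → IsPermutation (insertMin π k)
insertMin-permutation π zero    inj {zero}  {zero}  eq = ≡.refl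
insertMin-permutation π zero    inj {zero}  {suc j} eq with () ← ≡.trans eq (lookup-insertMin-fixed π j)
insertMin-permutation π zero    inj {suc i} {zero}  eq with () ← ≡.trans (≡.sym (lookup-insertMin-fixed π i)) eq
insertMin-permutation π zero    inj {suc i} {suc j} eq = ≡.cong suc (inj (Finₚ.suc-injective
  (≡.trans (≡.sym (lookup-insertMin-fixed π i)) (≡.trans eq (lookup-insertMin-fixed π j)))))
insertMin-permutation π (suc a) inj {i} {j} eq with i Finₚ.≟ suc a | j Finₚ.≟ suc a
... | yes ≡.refl | yes ≡.refl = ≡.refl
... | yes ≡.refl | no j≢a with () ← ≡.trans (≡.sym (lookup-insertMin-new π a)) (≡.trans eq (lookup-insertMin-source π a j j≢a))
... | no i≢a | yes ≡.refl with () ← ≡.trans (≡.sym (lookup-insertMin-source π a i i≢a)) (≡.trans eq (lookup-insertMin-new π a))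
... | no i≢a | no j≢a = sourceOf-injective a i≢a j≢a (inj (Finₚ.suc-injective
  (≡.trans (≡.sym (lookup-insertMin-source π a i i≢a)) (≡.trans eq (lookup-insertMin-source π a j j≢a)))))

removeMin-insertMin : ∀ {n} (π : Perm n) k → removeMin (insertMin π k) ≡ (π , k)
removeMin-insertMin π       zero    = ≡.cong (_, zero) (predAll-suc π)
removeMin-insertMin {suc n} π (suc a) = ≡.cong₂ _,_ restored (≡.cong suc p≡a)
  where
  w = Vec.map suc π Vec.[ a ]≔ zero
  p = positionOf w zero
  wp≡0 : lookup w p ≡ zero
  wp≡0 = lookup-positionOf w (a , lookup-insertMin-new π a)
  p≡a : p ≡ a
  p≡a with p Finₚ.≟ a
  ... | yes p≡a = p≡a
  ... | no  p≢a with () ← ≡.trans (≡.sym wp≡0) (lookup-insertMin-old π a p p≢a)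
  restored : predAll (w Vec.[ p ]≔ suc (lookup π a)) ≡ π
  restored = ≡.trans (≡.cong predAll (Vec-ext _ _ pointwise)) (predAll-suc π)
    where
    pointwise : ∀ j → lookup (w Vec.[ p ]≔ suc (lookup π a)) j ≡ lookup (Vec.map suc π) j
    pointwise j with j Finₚ.≟ a
    ... | yes ≡.refl = ≡.trans (≡.cong (λ q → lookup (w Vec.[ q ]≔ suc (lookup π j)) j) p≡a)
                         (≡.trans (Vecₚ.lookup∘updateAt j w) (≡.sym (Vecₚ.lookup-map j suc π)))
    ... | no  j≢a    = ≡.trans (Vecₚ.lookup∘updateAt′ j p (λ j≡p → j≢a (≡.trans j≡p p≡a)) w)
                         (Vecₚ.lookup∘updateAt′ j a j≢a (Vec.map suc π))

[]≔-injective : ∀ {A : Set} {n} (v : Vec A n) i {y} → Injective _≡_ _≡_ (lookup v) →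
  (∀ j → j ≢ i → lookup v j ≢ y) → Injective _≡_ _≡_ (lookup (v Vec.[ i ]≔ y))
[]≔-injective v i {y} inj y∉v {j} {k} eq with j Finₚ.≟ i | k Finₚ.≟ i
... | yes ≡.refl | yes ≡.refl = ≡.refl
... | yes ≡.refl | no k≢i = ⊥-elim (y∉v k k≢i (≡.trans (≡.sym (Vecₚ.lookup∘updateAt′ k i k≢i v))
                                                 (≡.trans (≡.sym eq) (Vecₚ.lookup∘updateAt j v))))
... | no j≢i | yes ≡.refl = ⊥-elim (y∉v j j≢i (≡.trans (≡.sym (Vecₚ.lookup∘updateAt′ j i j≢i v))
                                                 (≡.trans eq (Vecₚ.lookup∘updateAt k v))))
... | no j≢i | no k≢i = inj (≡.trans (≡.sym (Vecₚ.lookup∘updateAt′ j i j≢i v)) (≡.trans eq (Vecₚ.lookup∘updateAt′ k i k≢i v)))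

insertMin-removeMin : ∀ {n} (σ : Perm (suc n)) → IsPermutation σ →
  IsPermutation (proj₁ (removeMin σ)) × insertMin (proj₁ (removeMin σ)) (proj₂ (removeMin σ)) ≡ σ
insertMin-removeMin (zero ∷ rest) inj = π-permutation , ≡.cong (zero ∷_) (suc-predAll rest rest≢0)
  where
  rest≢0 : ∀ j → lookup rest j ≢ zero
  rest≢0 j eq with () ← inj {suc j} {zero} eq
  lookup-π : ∀ i → suc (lookup (predAll rest) i) ≡ lookup rest i
  lookup-π i = ≡.trans (≡.sym (Vecₚ.lookup-map i suc (predAll rest))) (≡.cong (λ u → lookup u i) (suc-predAll rest rest≢0))
  π-permutation : IsPermutation (predAll rest)
  π-permutation {i} {j} eq = Finₚ.suc-injective (inj (≡.trans (≡.sym (lookup-π i)) (≡.trans (≡.cong suc eq) (lookup-π j))))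
insertMin-removeMin {suc n} (suc c ∷ rest) inj = π-permutation , ≡.cong₂ _∷_ (≡.cong suc πa≡c) (Vec-ext _ _ pointwise)
  where
  a = positionOf rest zero
  zero∈rest : ∃ λ i → lookup rest i ≡ zero
  zero∈rest with IsPermutation⇒surjective (suc c ∷ rest) inj zero
  ... | suc i , eq = i , eq
  rest-a≡0 : lookup rest a ≡ zero
  rest-a≡0 = lookup-positionOf rest zero∈rest
  w = rest Vec.[ a ]≔ suc c
  w-injective : Injective _≡_ _≡_ (lookup w)
  w-injective = []≔-injective rest a (Finₚ.suc-injective ∘ inj) (λ j _ eq → case inj {suc j} {zero} eq of λ ())
  w≢0 : ∀ j → lookup w j ≢ zero
  w≢0 j eq with j Finₚ.≟ a
  ... | yes ≡.refl with () ← ≡.trans (≡.sym (Vecₚ.lookup∘updateAt j rest)) eq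
  ... | no  j≢a    = j≢a (Finₚ.suc-injective (inj {suc j} {suc a}
          (≡.trans (≡.sym (Vecₚ.lookup∘updateAt′ j a j≢a rest)) (≡.trans eq (≡.sym rest-a≡0)))))
  suc-π≡w : Vec.map suc (predAll w) ≡ w
  suc-π≡w = suc-predAll w w≢0
  lookup-π : ∀ i → suc (lookup (predAll w) i) ≡ lookup w i
  lookup-π i = ≡.trans (≡.sym (Vecₚ.lookup-map i suc (predAll w))) (≡.cong (λ u → lookup u i) suc-π≡w)
  π-permutation : IsPermutation (predAll w)
  π-permutation {i} {j} eq = w-injective (≡.trans (≡.sym (lookup-π i)) (≡.trans (≡.cong suc eq) (lookup-π j)))
  πa≡c : lookup (predAll w) a ≡ c
  πa≡c = Finₚ.suc-injective (≡.trans (lookup-π a) (Vecₚ.lookup∘updateAt a rest))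
  pointwise : ∀ j → lookup (Vec.map suc (predAll w) Vec.[ a ]≔ zero) j ≡ lookup rest j
  pointwise j with j Finₚ.≟ a
  ... | yes ≡.refl = ≡.trans (Vecₚ.lookup∘updateAt j (Vec.map suc (predAll w))) (≡.sym rest-a≡0)
  ... | no  j≢a    = ≡.trans (Vecₚ.lookup∘updateAt′ j a j≢a (Vec.map suc (predAll w)))
                       (≡.trans (≡.cong (λ u → lookup u j) suc-π≡w) (Vecₚ.lookup∘updateAt′ j a j≢a rest))

data CycleShape : Set where
  fixed cpeak cvalley cdasc cddes : CycleShape

-- Classified by: is the element fixed, is its preimage smaller, is its image larger.
cycleShapeOf : Bool → Bool → Bool → CycleShape
cycleShapeOf true  _     _     = fixed
cycleShapeOf false true  true  = cdasc
cycleShapeOf false true  false = cpeak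
cycleShapeOf false false true  = cvalley
cycleShapeOf false false false = cddes

-- The shape of a, given its preimage p and its image s.
cycleShapeAt : ℕ → ℕ → ℕ → CycleShape
cycleShapeAt p a s = cycleShapeOf (s ≡ᵇ a) (p <ᵇ a) (a <ᵇ s)

module _ {n : ℕ} (π : Perm n) where
  isFixed excedance fromBelow : Fin n → Bool
  isFixed a   = toℕ (lookup π a) ≡ᵇ toℕ a
  excedance a = toℕ a <ᵇ toℕ (lookup π a)
  fromBelow a = any (λ i → (toℕ i <ᵇ toℕ a) ∧ (toℕ (lookup π i) ≡ᵇ toℕ a)) (allFin n)

  cycleShape : Fin n → CycleShape
  cycleShape a = cycleShapeOf (isFixed a) (fromBelow a) (excedance a)

any-≡ : ∀ {A : Set} (p : A → Bool) {xs x} → Unique xs → x ∈ xs → (∀ y → y ≢ x → p y ≡ false) → any p xs ≡ p x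
any-≡ p {y ∷ xs} (y∉xs ∷ _) (here ≡.refl) others =
  ≡.trans (≡.cong (p y ∨_) (rest xs y∉xs)) (Boolₚ.∨-identityʳ (p y))
  where
  rest : ∀ zs → All (y ≢_) zs → any p zs ≡ false
  rest []       _             = ≡.refl
  rest (z ∷ zs) (y≢z ∷ y∉zs) = ≡.cong₂ _∨_ (others z (y≢z ∘ ≡.sym)) (rest zs y∉zs)
any-≡ p {y ∷ xs} (y∉xs ∷ u) (there x∈xs) others =
  ≡.trans (≡.cong (_∨ any p xs) (others y (λ y≡x → All.lookup y∉xs x∈xs y≡x))) (any-≡ p u x∈xs others)

fromBelow-preimage : ∀ {n} (π : Perm n) → IsPermutation π → ∀ {i a} → lookup π i ≡ a → fromBelow π a ≡ (toℕ i <ᵇ toℕ a)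
fromBelow-preimage {n} π inj {i} {a} πi≡a =
  ≡.trans (any-≡ _ (Uniqueₚ.allFin⁺ n) (∈-allFin i) others)
    (≡.trans (≡.cong (λ z → (toℕ i <ᵇ toℕ a) ∧ (toℕ z ≡ᵇ toℕ a)) πi≡a)
      (≡.trans (≡.cong ((toℕ i <ᵇ toℕ a) ∧_) (≡ᵇ-true (toℕ a))) (Boolₚ.∧-identityʳ _)))
  where
  others : ∀ j → j ≢ i → ((toℕ j <ᵇ toℕ a) ∧ (toℕ (lookup π j) ≡ᵇ toℕ a)) ≡ false
  others j j≢i = ≡.trans (≡.cong ((toℕ j <ᵇ toℕ a) ∧_) (≡ᵇ-false (λ πj≡a → j≢i (inj (≡.trans (Finₚ.toℕ-injective πj≡a) (≡.sym πi≡a))))))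
                         (Boolₚ.∧-zeroʳ _)

cycleShape-via : ∀ {n} (π : Perm n) → IsPermutation π → ∀ {i a s} → lookup π i ≡ a → lookup π a ≡ s →
  cycleShape π a ≡ cycleShapeAt (toℕ i) (toℕ a) (toℕ s)
cycleShape-via π inj {i} {a} πi≡a ≡.refl = ≡.cong (λ b → cycleShapeOf (isFixed π a) b (excedance π a)) (fromBelow-preimage π inj πi≡a)

module _ {n : ℕ} (π : Perm n) (inj : IsPermutation π) where
  private
    pre = preimage π inj

  cycleShape≡At : ∀ b → cycleShape π b ≡ cycleShapeAt (toℕ (pre b)) (toℕ b) (toℕ (lookup π b))
  cycleShape≡At b = cycleShape-via π inj (lookup-preimage π inj b) ≡.refl

  cycleShape-insertFixed : ∀ b → cycleShape (insertMin π zero) (suc b) ≡ cycleShape π b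
  cycleShape-insertFixed b =
    ≡.trans (cycleShape-via (insertMin π zero) (insertMin-permutation π zero inj) {i = suc (pre b)}
               (≡.trans (lookup-insertMin-fixed π (pre b)) (≡.cong suc (lookup-preimage π inj b))) (lookup-insertMin-fixed π b))
            (≡.sym (cycleShape≡At b))

  module InsertAfter (a : Fin n) where
    σ : Perm (suc n)
    σ = insertMin π (suc a)

    private
      σ-perm = insertMin-permutation π (suc a) inj

    cycleShape-new : cycleShape σ zero ≡ cvalley
    cycleShape-new = cycleShape-via σ σ-perm {i = suc a} (lookup-insertMin-new π a) ≡.refl

    cycleShape-unchanged : ∀ b → b ≢ a → b ≢ lookup π a → cycleShape σ (suc b) ≡ cycleShape π b
    cycleShape-unchanged b b≢a b≢πa =
      ≡.trans (cycleShape-via σ σ-perm {i = suc (pre b)}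
                 (≡.trans (lookup-insertMin-old π a (pre b) pre≢a) (≡.cong suc (lookup-preimage π inj b)))
                 (lookup-insertMin-old π a b b≢a))
              (≡.sym (cycleShape≡At b))
      where
      pre≢a : pre b ≢ a
      pre≢a pre≡a = b≢πa (≡.trans (≡.sym (lookup-preimage π inj b)) (≡.cong (lookup π) pre≡a))

    cycleShape-fixed : lookup π a ≡ a → cycleShape σ (suc a) ≡ cpeak
    cycleShape-fixed πa≡a = cycleShape-via σ σ-perm {i = zero} (≡.cong suc πa≡a) (lookup-insertMin-new π a)

    cycleShape-source : lookup π a ≢ a → cycleShape σ (suc a) ≡ cycleShapeOf false (toℕ (pre a) <ᵇ toℕ a) false
    cycleShape-source πa≢a =
      cycleShape-via σ σ-perm {i = suc (pre a)} (≡.trans (lookup-insertMin-old π a (pre a) pre≢a) (≡.cong suc (lookup-preimage π inj a)))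
        (lookup-insertMin-new π a)
      where
      pre≢a : pre a ≢ a
      pre≢a pre≡a = πa≢a (≡.trans (≡.cong (lookup π) (≡.sym pre≡a)) (lookup-preimage π inj a))

    cycleShape-target : lookup π a ≢ a →
      cycleShape σ (suc (lookup π a)) ≡ cycleShapeOf (isFixed π (lookup π a)) true (excedance π (lookup π a))
    cycleShape-target πa≢a = cycleShape-via σ σ-perm {i = zero} ≡.refl (lookup-insertMin-old π a (lookup π a) πa≢a)

    cycleShape-image : cycleShape π (lookup π a) ≡
      cycleShapeOf (isFixed π (lookup π a)) (toℕ a <ᵇ toℕ (lookup π a)) (excedance π (lookup π a))
    cycleShape-image = cycleShape-via π inj ≡.refl ≡.refl

-- The recursion for the cycle polynomial

module _ {c ℓ : Level} (R : CommutativeSemiring c ℓ) where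
  open CommutativeSemiring R hiding (zero)
  open FinSums R

  cycleWeight : (q x y f : Carrier) → CycleShape → Carrier
  cycleWeight q x y f fixed   = f
  cycleWeight q x y f cpeak   = 1#
  cycleWeight q x y f cvalley = q
  cycleWeight q x y f cdasc   = x
  cycleWeight q x y f cddes   = y

  Cyc : ℕ → (q x y f : Carrier) → Carrier
  Cyc n q x y f = sumList R (λ π → product (λ a → cycleWeight q x y f (cycleShape π a))) (𝔖 n)

  product-except : ∀ {n} (G g : Fin (suc n) → Carrier) b → (∀ i → i ≢ b → G i ≈ g i) → product G ≈ G b * productWithout g b
  product-except G g b G≈g = trans (product-remove {i = b} G)
    (*-cong refl (product-cong-≋ {x = removeAt G b} {y = removeAt g b} (λ j → G≈g (punchIn b j) (Finₚ.punchInᵢ≢i b j))))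

module _ {c ℓ : Level} (R : CommutativeSemiring c ℓ) (q x y f : CommutativeSemiring.Carrier R) where
  open CommutativeSemiring R hiding (zero)
  open FinSums R
  open NaturalSolver R
  open import Relation.Binary.Reasoning.Setoid setoid
  private
    module D = FinSums (dualNumbers R)
    τ = cycleWeight R q x y f

  -- Putting 0 right after a changes the shape of a if a is fixed or an excedance, and otherwise
  -- that of π a; the charge is the new weight of the changed element.
  chargeSource chargeTarget : CycleShape → Carrier
  chargeSource fixed   = 1#
  chargeSource cdasc   = 1#
  chargeSource cvalley = y
  chargeSource _       = 0#
  chargeTarget cvalley = x
  chargeTarget cddes   = 1#
  chargeTarget _       = 0#

  dualCycleWeight : CycleShape → Carrier × Carrier
  dualCycleWeight = cycleWeight (dualNumbers R) (q , q * (x + y)) (x , q) (y , q) (f , q)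

  dualCycleWeight-primal : ∀ S → proj₁ (dualCycleWeight S) ≡ τ S
  dualCycleWeight-primal fixed   = ≡.refl
  dualCycleWeight-primal cpeak   = ≡.refl
  dualCycleWeight-primal cvalley = ≡.refl
  dualCycleWeight-primal cdasc   = ≡.refl
  dualCycleWeight-primal cddes   = ≡.refl

  dualCycleWeight-tangent : ∀ S → proj₂ (dualCycleWeight S) ≈ q * (chargeSource S + chargeTarget S)
  dualCycleWeight-tangent fixed   = solve 1 (λ q → q := q :* (con 1 :+ con 0)) refl q
  dualCycleWeight-tangent cpeak   = sym (trans (*-cong refl (+-identityʳ 0#)) (zeroʳ q))
  dualCycleWeight-tangent cvalley = solve 3 (λ q x y → q :* (x :+ y) := q :* (y :+ x)) refl q x y
  dualCycleWeight-tangent cdasc   = solve 1 (λ q → q := q :* (con 1 :+ con 0)) refl q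
  dualCycleWeight-tangent cddes   = solve 1 (λ q → q := q :* (con 0 :+ con 1)) refl q

  private
    source-charge : ∀ L → τ (cycleShapeOf false L false) ≡ chargeSource (cycleShapeOf false L true)
    source-charge true  = ≡.refl
    source-charge false = ≡.refl

    target-charge : ∀ E → τ (cycleShapeOf false true E) ≡ chargeTarget (cycleShapeOf false false E)
    target-charge true  = ≡.refl
    target-charge false = ≡.refl

    chargeSource-noExcedance : ∀ L → chargeSource (cycleShapeOf false L false) ≡ 0#
    chargeSource-noExcedance true  = ≡.refl
    chargeSource-noExcedance false = ≡.refl

    chargeTarget-fromBelow : ∀ F E → chargeTarget (cycleShapeOf F true E) ≡ 0#
    chargeTarget-fromBelow true  _     = ≡.refl
    chargeTarget-fromBelow false true  = ≡.refl
    chargeTarget-fromBelow false false = ≡.refl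

  module _ {n : ℕ} (π : Perm (suc n)) (inj : IsPermutation π) (a : Fin (suc n)) where
    open InsertAfter π inj a
    private
      πa = lookup π a
      g G : Fin (suc n) → Carrier
      g b = τ (cycleShape π b)
      G b = τ (cycleShape σ (suc b))
      without = productWithout g
      L = toℕ (preimage π inj a) <ᵇ toℕ a
      E = excedance π πa

      charged : Carrier
      charged = q * (chargeSource (cycleShape π a) * without a + chargeTarget (cycleShape π πa) * without πa)

      shape-a : πa ≢ a → cycleShape π a ≡ cycleShapeOf false L (toℕ a <ᵇ toℕ πa)
      shape-a πa≢a = ≡.trans (cycleShape≡At π inj a)
        (≡.cong (λ b → cycleShapeOf b L (toℕ a <ᵇ toℕ πa)) (≡ᵇ-false (πa≢a ∘ Finₚ.toℕ-injective)))

      shape-πa : cycleShape π πa ≡ cycleShapeOf (isFixed π πa) (toℕ a <ᵇ toℕ πa) E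
      shape-πa = cycleShape-image

      σ-weight : product (λ i → τ (cycleShape σ i)) ≈ q * product G
      σ-weight = *-cong (reflexive (≡.cong τ cycleShape-new)) refl

    insertAfter-fixed : πa ≡ a → product (λ i → τ (cycleShape σ i)) ≈ charged
    insertAfter-fixed πa≡a = begin
      product (λ i → τ (cycleShape σ i))
        ≈⟨ trans σ-weight (*-cong refl (product-except R G g a unchanged)) ⟩
      q * (τ (cycleShape σ (suc a)) * without a)
        ≡⟨ ≡.cong (λ S → q * (τ S * without a)) (cycleShape-fixed πa≡a) ⟩
      q * (1# * without a)
        ≈⟨ solve 3 (λ q w w′ → q :* (con 1 :* w) := q :* (con 1 :* w :+ con 0 :* w′)) refl q _ (without πa) ⟩
      q * (chargeSource fixed * without a + chargeTarget fixed * without πa)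
        ≡⟨ ≡.cong₂ (λ S S′ → q * (chargeSource S * without a + chargeTarget S′ * without πa))
                   (≡.sym a-fixed) (≡.sym (≡.trans (≡.cong (cycleShape π) πa≡a) a-fixed)) ⟩
      charged ∎
      where
      a-fixed : cycleShape π a ≡ fixed
      a-fixed = ≡.cong (λ b → cycleShapeOf b (fromBelow π a) (excedance π a))
                       (≡.trans (≡.cong (λ z → toℕ z ≡ᵇ toℕ a) πa≡a) (≡ᵇ-true (toℕ a)))
      unchanged : ∀ b → b ≢ a → G b ≈ g b
      unchanged b b≢a = reflexive (≡.cong τ (cycleShape-unchanged b b≢a (λ b≡πa → b≢a (≡.trans b≡πa πa≡a))))

    insertAfter-excedance : toℕ a < toℕ πa → product (λ i → τ (cycleShape σ i)) ≈ charged
    insertAfter-excedance a<πa = begin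
      product (λ i → τ (cycleShape σ i))
        ≈⟨ trans σ-weight (*-cong refl (product-except R G g a unchanged)) ⟩
      q * (τ (cycleShape σ (suc a)) * without a)
        ≡⟨ ≡.cong (λ S → q * (τ S * without a)) (cycleShape-source πa≢a) ⟩
      q * (τ (cycleShapeOf false L false) * without a)
        ≡⟨ ≡.cong (λ c → q * (c * without a)) (source-charge L) ⟩
      q * (chargeSource (cycleShapeOf false L true) * without a)
        ≈⟨ solve 4 (λ q c w w′ → q :* (c :* w) := q :* (c :* w :+ con 0 :* w′)) refl q _ _ (without πa) ⟩
      q * (chargeSource (cycleShapeOf false L true) * without a + 0# * without πa)
        ≡⟨ ≡.cong₂ (λ S c → q * (chargeSource S * without a + c * without πa)) (≡.sym source-shape) (≡.sym target-uncharged) ⟩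
      charged ∎
      where
      πa≢a : πa ≢ a
      πa≢a πa≡a = ℕₚ.<⇒≢ a<πa (≡.cong toℕ (≡.sym πa≡a))
      source-shape : cycleShape π a ≡ cycleShapeOf false L true
      source-shape = ≡.trans (shape-a πa≢a) (≡.cong (cycleShapeOf false L) (<ᵇ-true a<πa))
      target-shape : cycleShape π πa ≡ cycleShapeOf (isFixed π πa) true E
      target-shape = ≡.trans shape-πa (≡.cong (λ b → cycleShapeOf (isFixed π πa) b E) (<ᵇ-true a<πa))
      target-uncharged : chargeTarget (cycleShape π πa) ≡ 0#
      target-uncharged = ≡.trans (≡.cong chargeTarget target-shape) (chargeTarget-fromBelow (isFixed π πa) E)
      unchanged : ∀ b → b ≢ a → G b ≈ g b
      unchanged b b≢a with b Finₚ.≟ πa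
      ... | no  b≢πa   = reflexive (≡.cong τ (cycleShape-unchanged b b≢a b≢πa))
      ... | yes ≡.refl = reflexive (≡.cong τ (≡.trans (cycleShape-target πa≢a) (≡.sym target-shape)))

    insertAfter-deficiency : toℕ πa < toℕ a → product (λ i → τ (cycleShape σ i)) ≈ charged
    insertAfter-deficiency πa<a = begin
      product (λ i → τ (cycleShape σ i))
        ≈⟨ trans σ-weight (*-cong refl (product-except R G g πa unchanged)) ⟩
      q * (τ (cycleShape σ (suc πa)) * without πa)
        ≡⟨ ≡.cong (λ S → q * (τ S * without πa)) (≡.trans (cycleShape-target πa≢a) (≡.cong (λ b → cycleShapeOf b true E) πa-moves)) ⟩
      q * (τ (cycleShapeOf false true E) * without πa)
        ≡⟨ ≡.cong (λ c → q * (c * without πa)) (target-charge E) ⟩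
      q * (chargeTarget (cycleShapeOf false false E) * without πa)
        ≈⟨ solve 4 (λ q c w w′ → q :* (c :* w) := q :* (con 0 :* w′ :+ c :* w)) refl q _ _ (without a) ⟩
      q * (0# * without a + chargeTarget (cycleShapeOf false false E) * without πa)
        ≡⟨ ≡.cong₂ (λ c S → q * (c * without a + chargeTarget S * without πa)) (≡.sym source-uncharged) (≡.sym target-shape) ⟩
      charged ∎
      where
      πa≢a : πa ≢ a
      πa≢a πa≡a = ℕₚ.<⇒≢ πa<a (≡.cong toℕ πa≡a)
      πa-moves : isFixed π πa ≡ false
      πa-moves = ≡ᵇ-false (πa≢a ∘ inj ∘ Finₚ.toℕ-injective)
      target-shape : cycleShape π πa ≡ cycleShapeOf false false E
      target-shape = ≡.trans shape-πa (≡.cong₂ (λ b b′ → cycleShapeOf b b′ E) πa-moves (<ᵇ-false (ℕₚ.<⇒≤ πa<a)))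
      source-shape : cycleShape π a ≡ cycleShapeOf false L false
      source-shape = ≡.trans (shape-a πa≢a) (≡.cong (cycleShapeOf false L) (<ᵇ-false (ℕₚ.<⇒≤ πa<a)))
      source-uncharged : chargeSource (cycleShape π a) ≡ 0#
      source-uncharged = ≡.trans (≡.cong chargeSource source-shape) (chargeSource-noExcedance L)
      unchanged : ∀ b → b ≢ πa → G b ≈ g b
      unchanged b b≢πa with b Finₚ.≟ a
      ... | no  b≢a    = reflexive (≡.cong τ (cycleShape-unchanged b b≢a b≢πa))
      ... | yes ≡.refl = reflexive (≡.cong τ (≡.trans (cycleShape-source πa≢a) (≡.sym source-shape)))

    insertAfter-weight :
      product (λ i → τ (cycleShape σ i)) ≈ q * (chargeSource (cycleShape π a) * without a + chargeTarget (cycleShape π πa) * without πa)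
    insertAfter-weight with ℕₚ.<-cmp (toℕ a) (toℕ πa)
    ... | tri< a<πa _ _ = insertAfter-excedance a<πa
    ... | tri≈ _ a≡πa _ = insertAfter-fixed (Finₚ.toℕ-injective (≡.sym a≡πa))
    ... | tri> _ _ πa<a = insertAfter-deficiency πa<a

  private
    insertFixed-weight : ∀ {n} (π : Perm n) → IsPermutation π →
      product (τ ∘ cycleShape (insertMin π zero)) ≈ f * product (τ ∘ cycleShape π)
    insertFixed-weight π inj = *-cong refl (product-cong-≋ {x = λ b → τ (cycleShape (insertMin π zero) (suc b))} {y = τ ∘ cycleShape π}
                                 (λ b → reflexive (≡.cong τ (cycleShape-insertFixed π inj b))))

  insertMin-weights : ∀ {n} (π : Perm n) → IsPermutation π →
    sum (λ k → product (τ ∘ cycleShape (insertMin π k))) ≈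
    f * product (τ ∘ cycleShape π) + proj₂ (D.product (dualCycleWeight ∘ cycleShape π))
  insertMin-weights {zero}  [] _   = refl
  insertMin-weights {suc n} π  inj = begin
    product (τ ∘ cycleShape (insertMin π zero)) + sum (λ a → product (τ ∘ cycleShape (insertMin π (suc a))))
      ≈⟨ +-cong (insertFixed-weight π inj) (sum-cong-≋ {x = λ a → product (τ ∘ cycleShape (insertMin π (suc a)))} {y = charged}
                                                          (insertAfter-weight π inj)) ⟩
    f * product g + sum charged
      ≈⟨ +-cong refl (sym (*-distribˡ-sum q (λ a → source a + target (lookup π a)))) ⟩
    f * product g + q * sum (λ a → source a + target (lookup π a))
      ≈⟨ +-cong refl (*-cong refl (trans (∑-distrib-+ source (target ∘ lookup π))
                                         (+-cong refl (sym (sum-reindex R π inj target))))) ⟩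
    f * product g + q * (sum source + sum target)
      ≈⟨ +-cong refl (*-cong refl (sym (∑-distrib-+ source target))) ⟩
    f * product g + q * sum (λ b → source b + target b)
      ≈⟨ +-cong refl (*-distribˡ-sum q (λ b → source b + target b)) ⟩
    f * product g + sum (λ b → q * (source b + target b))
      ≈⟨ +-cong refl (sum-cong-≋ {x = λ b → q * (source b + target b)} {y = λ b → proj₂ (h b) * productWithout (proj₁ ∘ h) b} at) ⟩
    f * product g + sum (λ b → proj₂ (h b) * productWithout (proj₁ ∘ h) b)
      ≈⟨ +-cong refl (sym (product-tangent R h)) ⟩
    f * product g + proj₂ (D.product h) ∎
    where
    g = τ ∘ cycleShape π
    h = dualCycleWeight ∘ cycleShape π
    without = productWithout g
    source target charged : Fin (suc n) → Carrier
    source b = chargeSource (cycleShape π b) * without b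
    target b = chargeTarget (cycleShape π b) * without b
    charged a = q * (source a + target (lookup π a))
    at : ∀ b → q * (source b + target b) ≈ proj₂ (h b) * productWithout (proj₁ ∘ h) b
    at b = begin
      q * (chargeSource S * without b + chargeTarget S * without b)
        ≈⟨ solve 4 (λ q s t w → q :* (s :* w :+ t :* w) := q :* (s :+ t) :* w) refl q _ _ _ ⟩
      q * (chargeSource S + chargeTarget S) * without b
        ≈⟨ *-cong (sym (dualCycleWeight-tangent S))
                  (product-cong-≋ {x = removeAt g b} {y = removeAt (proj₁ ∘ h) b}
                     (λ j → reflexive (≡.sym (dualCycleWeight-primal (cycleShape π (punchIn b j)))))) ⟩
      proj₂ (h b) * productWithout (proj₁ ∘ h) b ∎
      where S = cycleShape π b

  Cyc-suc : ∀ n → Cyc R (suc n) q x y f ≈ f * Cyc R n q x y f + proj₂ (Cyc (dualNumbers R) n (q , q * (x + y)) (x , q) (y , q) (f , q))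
  Cyc-suc n = begin
    sumList R (λ σ → product (τ ∘ cycleShape σ)) (𝔖 (suc n))
      ≈⟨ sum-𝔖-suc R {n} insertMin removeMin removeMin-insertMin insertMin-permutation insertMin-removeMin
           (λ σ → product (τ ∘ cycleShape σ)) ⟩
    sumList R (λ π → sum (λ k → product (τ ∘ cycleShape (insertMin π k)))) (𝔖 n)
      ≈⟨ sumList-cong-∈ R (𝔖 n) (λ π π∈𝔖 → insertMin-weights π (∈-𝔖⁻ π∈𝔖)) ⟩
    sumList R (λ π → f * product (τ ∘ cycleShape π) + proj₂ (D.product (dualCycleWeight ∘ cycleShape π))) (𝔖 n)
      ≈⟨ sumList-+ R _ _ (𝔖 n) ⟩
    sumList R (λ π → f * product (τ ∘ cycleShape π)) (𝔖 n) + sumList R (λ π → proj₂ (D.product (dualCycleWeight ∘ cycleShape π))) (𝔖 n)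
      ≈⟨ +-cong (sym (*-distribˡ-sumList R f _ (𝔖 n))) (sym (sumList-tangent R _ (𝔖 n))) ⟩
    f * Cyc R n q x y f + proj₂ (Cyc (dualNumbers R) n (q , q * (x + y)) (x , q) (y , q) (f , q)) ∎

module _ {c₁ ℓ₁ c₂ ℓ₂} (R₁ : CommutativeSemiring c₁ ℓ₁) (R₂ : CommutativeSemiring c₂ ℓ₂)
         (h : Homomorphism R₁ R₂) where
  open SemiringHomomorphism h
  open CommutativeSemiring R₂ hiding (zero)

  cycleWeight-homo : ∀ q x y f S → ⟦ cycleWeight R₁ q x y f S ⟧ ≈ cycleWeight R₂ ⟦ q ⟧ ⟦ x ⟧ ⟦ y ⟧ ⟦ f ⟧ S
  cycleWeight-homo q x y f fixed   = refl
  cycleWeight-homo q x y f cpeak   = 1#-homo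
  cycleWeight-homo q x y f cvalley = refl
  cycleWeight-homo q x y f cdasc   = refl
  cycleWeight-homo q x y f cddes   = refl

  Cyc-homo : ∀ n q x y f → ⟦ Cyc R₁ n q x y f ⟧ ≈ Cyc R₂ n ⟦ q ⟧ ⟦ x ⟧ ⟦ y ⟧ ⟦ f ⟧
  Cyc-homo n q x y f = trans (sumList-homo R₁ R₂ h _ (𝔖 n)) (sumList-cong-∈ R₂ (𝔖 n) (λ π _ →
    trans (product-homo R₁ R₂ h (λ a → cycleWeight R₁ q x y f (cycleShape π a)))
          (FinSums.product-cong-≋ R₂ {x = λ a → ⟦ cycleWeight R₁ q x y f (cycleShape π a) ⟧}
                                     {y = λ a → cycleWeight R₂ ⟦ q ⟧ ⟦ x ⟧ ⟦ y ⟧ ⟦ f ⟧ (cycleShape π a)}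
                                     (λ a → cycleWeight-homo q x y f (cycleShape π a)))))

module _ {c ℓ : Level} (R : CommutativeSemiring c ℓ) where
  open CommutativeSemiring R hiding (zero)

  cycleWeight-cong : ∀ {q x y f q′ x′ y′ f′} → q ≈ q′ → x ≈ x′ → y ≈ y′ → f ≈ f′ →
    ∀ S → cycleWeight R q x y f S ≈ cycleWeight R q′ x′ y′ f′ S
  cycleWeight-cong q≈ x≈ y≈ f≈ fixed   = f≈
  cycleWeight-cong q≈ x≈ y≈ f≈ cpeak   = refl
  cycleWeight-cong q≈ x≈ y≈ f≈ cvalley = q≈
  cycleWeight-cong q≈ x≈ y≈ f≈ cdasc   = x≈
  cycleWeight-cong q≈ x≈ y≈ f≈ cddes   = y≈

  Cyc-cong : ∀ n {q x y f q′ x′ y′ f′} → q ≈ q′ → x ≈ x′ → y ≈ y′ → f ≈ f′ → Cyc R n q x y f ≈ Cyc R n q′ x′ y′ f′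
  Cyc-cong n q≈ x≈ y≈ f≈ = sumList-cong-∈ R (𝔖 n) (λ π _ →
    FinSums.product-cong-≋ R {x = λ a → cycleWeight R _ _ _ _ (cycleShape π a)} {y = λ a → cycleWeight R _ _ _ _ (cycleShape π a)}
                             (λ a → cycleWeight-cong q≈ x≈ y≈ f≈ (cycleShape π a)))

-- The recurrence Cyc-suc treats cycle double ascents and double descents alike.
Cyc-symmetric : ∀ {c ℓ} (R : CommutativeSemiring c ℓ) n q x y f →
  CommutativeSemiring._≈_ R (Cyc R n q x y f) (Cyc R n q (CommutativeSemiring.0# R) (CommutativeSemiring._+_ R x y) f)
Cyc-symmetric R zero    q x y f = CommutativeSemiring.refl R
Cyc-symmetric R (suc n) q x y f = begin
  Cyc R (suc n) q x y f
    ≈⟨ Cyc-suc R q x y f n ⟩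
  f * Cyc R n q x y f + proj₂ (Cyc D n (q , q * (x + y)) (x , q) (y , q) (f , q))
    ≈⟨ +-cong (*-cong refl (Cyc-symmetric R n q x y f)) (proj₂ (Cyc-symmetric D n (q , q * (x + y)) (x , q) (y , q) (f , q))) ⟩
  f * Cyc R n q 0# (x + y) f + proj₂ (Cyc D n (q , q * (x + y)) (0# , 0#) (x + y , q + q) (f , q))
    ≈⟨ +-cong refl (proj₂ (Cyc-cong D n (refl , *-cong refl (sym (+-identityˡ _))) (refl , refl)
                                        (sym (+-identityˡ _) , refl) (refl , refl))) ⟩
  f * Cyc R n q 0# (x + y) f + proj₂ (Cyc D n (q , q * (0# + (x + y))) (0# , 0#) (0# + (x + y) , q + q) (f , q))
    ≈⟨ +-cong refl (proj₂ (Cyc-symmetric D n (q , q * (0# + (x + y))) (0# , q) (x + y , q) (f , q))) ⟨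
  f * Cyc R n q 0# (x + y) f + proj₂ (Cyc D n (q , q * (0# + (x + y))) (0# , q) (x + y , q) (f , q))
    ≈⟨ Cyc-suc R q 0# (x + y) f n ⟨
  Cyc R (suc n) q 0# (x + y) f ∎
  where
  open CommutativeSemiring R hiding (zero)
  open import Relation.Binary.Reasoning.Setoid setoid
  D = dualNumbers R

-- Comparison of the two recursions

module _ {c ℓ : Level} (R : CommutativeSemiring c ℓ) (n : ℕ) (α₁ α₂ α₃ α₄ : CommutativeSemiring.Carrier R) where
  open CommutativeSemiring R hiding (zero)
  open NaturalSolver R
  private
    D = dualNumbers R
    module D = CommutativeSemiring D
    q = α₁ * α₂
    e = α₃ + α₄
    V₁ V₂ V₃ V₄ : Carrier × Carrier
    V₁ = q , e * α₂
    V₂ = 0# , 0#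
    V₃ = e , α₂ + α₂
    V₄ = α₄ , α₂

  -- The common tangent of both recurrences, up to a scalar.
  sharedTangent : Carrier
  sharedTangent = proj₂ (Cyc D n V₁ V₂ V₃ V₄)

  private
    scaled : ∀ k {Q X Y F} → Q D.≈ (q , k * (e * α₂)) → X D.≈ (0# , k * 0#) → Y D.≈ (e , k * (α₂ + α₂)) → F D.≈ (α₄ , k * α₂) →
      proj₂ (Cyc D n Q X Y F) ≈ k * sharedTangent
    scaled k Q≈ X≈ Y≈ F≈ = proj₂ (D.trans (Cyc-cong D n Q≈ X≈ Y≈ F≈) (D.sym (Cyc-homo D D (scaleTangent R k) n V₁ V₂ V₃ V₄)))

  linear-tangent : ∀ ω → proj₂ (Cyc D n ((α₁ , ω * e) D.* (α₂ , 0#)) D.0# ((α₃ , ω * α₂) D.+ (α₄ , ω * α₂)) (α₄ , ω * α₂)) ≈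
                         ω * sharedTangent
  linear-tangent ω = scaled ω
    (refl , solve 5 (λ a₁ a₂ ω a₃ a₄ → a₁ :* con 0 :+ ω :* (a₃ :+ a₄) :* a₂ := ω :* ((a₃ :+ a₄) :* a₂)) refl α₁ α₂ ω α₃ α₄)
    (refl , sym (zeroʳ ω)) (refl , sym (distribˡ ω α₂ α₂)) (refl , refl)

  cyclic-tangent : Cyc R (suc n) q 0# e α₄ ≈ α₄ * Cyc R n q 0# e α₄ + α₁ * sharedTangent
  cyclic-tangent = trans (Cyc-suc R q 0# e α₄ n) (+-cong refl (trans
    (proj₂ (Cyc-symmetric D n (q , q * (0# + e)) (0# , q) (e , q) (α₄ , q)))
    (scaled α₁ (refl , solve 4 (λ a₁ a₂ a₃ a₄ → a₁ :* a₂ :* (con 0 :+ (a₃ :+ a₄)) := a₁ :* ((a₃ :+ a₄) :* a₂)) refl α₁ α₂ α₃ α₄)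
               (refl , sym (zeroʳ α₁)) (+-identityˡ e , sym (distribˡ α₁ α₂ α₂)) (refl , refl))))

Atop≈Cyc : ∀ {c ℓ} (R : CommutativeSemiring c ℓ) n α₁ α₂ α₃ α₄ ω → let open CommutativeSemiring R in
  Atop R n α₁ α₂ α₃ α₄ ω ≈ ω * Cyc R n (α₁ * α₂) 0# (α₃ + α₄) α₄
Atop≈Cyc R zero    α₁ α₂ α₃ α₄ ω = trans (Atop-zero R α₁ α₂ α₃ α₄ ω) (solve 1 (λ ω → ω := ω :* (con 1 :+ con 0)) refl ω)
  where
  open CommutativeSemiring R hiding (zero)
  open NaturalSolver R
Atop≈Cyc R (suc n) α₁ α₂ α₃ α₄ ω = begin
  Atop R (suc n) α₁ α₂ α₃ α₄ ω
    ≈⟨ Atop-suc R n α₁ α₂ α₃ α₄ ω ⟩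
  proj₂ (Atop D n (α₁ , ω * e) (α₂ , 0#) (α₃ , ω * α₂) (α₄ , ω * α₂) (α₁ , ω * α₄))
    ≈⟨ proj₂ (Atop≈Cyc D n (α₁ , ω * e) (α₂ , 0#) (α₃ , ω * α₂) (α₄ , ω * α₂) (α₁ , ω * α₄)) ⟩
  α₁ * proj₂ Cyc′ + (ω * α₄) * proj₁ Cyc′
    ≈⟨ +-cong (*-cong refl (linear-tangent R n α₁ α₂ α₃ α₄ ω)) (*-cong refl (Cyc-homo D R (primalPart R) n _ _ _ _)) ⟩
  α₁ * (ω * sharedTangent R n α₁ α₂ α₃ α₄) + (ω * α₄) * Cyc R n q 0# e α₄
    ≈⟨ solve 5 (λ a₁ ω t a₄ r → a₁ :* (ω :* t) :+ (ω :* a₄) :* r := ω :* (a₄ :* r :+ a₁ :* t)) refl α₁ ω _ α₄ _ ⟩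
  ω * (α₄ * Cyc R n q 0# e α₄ + α₁ * sharedTangent R n α₁ α₂ α₃ α₄)
    ≈⟨ *-cong refl (cyclic-tangent R n α₁ α₂ α₃ α₄) ⟨
  ω * Cyc R (suc n) q 0# e α₄ ∎
  where
  open CommutativeSemiring R hiding (zero)
  open NaturalSolver R
  open import Relation.Binary.Reasoning.Setoid setoid
  D = dualNumbers R
  module D = CommutativeSemiring D
  q = α₁ * α₂
  e = α₃ + α₄
  Cyc′ = Cyc D n ((α₁ , ω * e) D.* (α₂ , 0#)) D.0# ((α₃ , ω * α₂) D.+ (α₄ , ω * α₂)) (α₄ , ω * α₂)

-- Permutations without cycle double ascents

private
  module ℕSum = FinSums ℕₚ.+-*-commutativeSemiring

#_ : ∀ {n} → (Fin n → Bool) → ℕ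
# p = ℕSum.sum (indicator ∘ p)

count-tabulate : ∀ {A : Set} {n} (p : A → Bool) (g : Fin n → A) → count p (tabulate g) ≡ # (p ∘ g)
count-tabulate {n = zero}  p g = ≡.refl
count-tabulate {n = suc n} p g with p (g zero)
... | true  = ≡.cong suc (count-tabulate p (g ∘ suc))
... | false = count-tabulate p (g ∘ suc)

#-cong : ∀ {n} {p p′ : Fin n → Bool} → (∀ a → p a ≡ p′ a) → # p ≡ # p′
#-cong p≗p′ = ℕSum.sum-cong-≋ (≡.cong indicator ∘ p≗p′)

#-split : ∀ {n} (p p₁ p₂ : Fin n → Bool) → (∀ a → indicator (p a) ≡ indicator (p₁ a) ℕ.+ indicator (p₂ a)) → # p ≡ # p₁ ℕ.+ # p₂
#-split p p₁ p₂ split = ≡.trans (ℕSum.sum-cong-≋ {x = indicator ∘ p} {y = λ a → indicator (p₁ a) ℕ.+ indicator (p₂ a)} split)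
                                (ℕSum.∑-distrib-+ (indicator ∘ p₁) (indicator ∘ p₂))

is : CycleShape → CycleShape → Bool
is fixed   fixed   = true
is cpeak   cpeak   = true
is cvalley cvalley = true
is cdasc   cdasc   = true
is cddes   cddes   = true
is _       _       = false

shapes-partition : ∀ {n} (S : Fin n → CycleShape) →
  # (is fixed ∘ S) ℕ.+ # (is cpeak ∘ S) ℕ.+ # (is cvalley ∘ S) ℕ.+ # (is cdasc ∘ S) ℕ.+ # (is cddes ∘ S) ≡ n
shapes-partition {zero}  S = ≡.refl
shapes-partition {suc n} S =
  ≡.trans (regroup (at fixed) (at cpeak) (at cvalley) (at cdasc) (at cddes)
                   (rest fixed) (rest cpeak) (rest cvalley) (rest cdasc) (rest cddes))
          (≡.cong₂ ℕ._+_ (one-shape (S zero)) (shapes-partition (S ∘ suc)))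
  where
  open import Data.Nat.Solver using (module +-*-Solver)
  open +-*-Solver
  at rest : CycleShape → ℕ
  at T = indicator (is T (S zero))
  rest T = # (is T ∘ S ∘ suc)
  regroup : ∀ a b c d e a′ b′ c′ d′ e′ →
    (a ℕ.+ a′) ℕ.+ (b ℕ.+ b′) ℕ.+ (c ℕ.+ c′) ℕ.+ (d ℕ.+ d′) ℕ.+ (e ℕ.+ e′) ≡
    (a ℕ.+ b ℕ.+ c ℕ.+ d ℕ.+ e) ℕ.+ (a′ ℕ.+ b′ ℕ.+ c′ ℕ.+ d′ ℕ.+ e′)
  regroup = solve 10 (λ a b c d e a′ b′ c′ d′ e′ → (a :+ a′) :+ (b :+ b′) :+ (c :+ c′) :+ (d :+ d′) :+ (e :+ e′)
                                                  := (a :+ b :+ c :+ d :+ e) :+ (a′ :+ b′ :+ c′ :+ d′ :+ e′)) ≡.refl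
  one-shape : ∀ T → indicator (is fixed T) ℕ.+ indicator (is cpeak T) ℕ.+ indicator (is cvalley T)
                    ℕ.+ indicator (is cdasc T) ℕ.+ indicator (is cddes T) ≡ 1
  one-shape fixed   = ≡.refl
  one-shape cpeak   = ≡.refl
  one-shape cvalley = ≡.refl
  one-shape cdasc   = ≡.refl
  one-shape cddes   = ≡.refl

private
  fixed-indicator : ∀ F L E → F ≡ is fixed (cycleShapeOf F L E)
  fixed-indicator true  _     _     = ≡.refl
  fixed-indicator false true  true  = ≡.refl
  fixed-indicator false true  false = ≡.refl
  fixed-indicator false false true  = ≡.refl
  fixed-indicator false false false = ≡.refl

  cdasc-indicator : ∀ F L E → (E ≡ true → F ≡ false) → (E ∧ L) ≡ is cdasc (cycleShapeOf F L E)
  cdasc-indicator true  _     true  moved with () ← moved ≡.refl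
  cdasc-indicator true  _     false _ = ≡.refl
  cdasc-indicator false true  true  _ = ≡.refl
  cdasc-indicator false true  false _ = ≡.refl
  cdasc-indicator false false true  _ = ≡.refl
  cdasc-indicator false false false _ = ≡.refl

  excedance-indicator : ∀ F L E → (E ≡ true → F ≡ false) →
    indicator E ≡ indicator (is cvalley (cycleShapeOf F L E)) ℕ.+ indicator (is cdasc (cycleShapeOf F L E))
  excedance-indicator true  _     true  moved with () ← moved ≡.refl
  excedance-indicator true  _     false _ = ≡.refl
  excedance-indicator false true  true  _ = ≡.refl
  excedance-indicator false true  false _ = ≡.refl
  excedance-indicator false false true  _ = ≡.refl
  excedance-indicator false false false _ = ≡.refl

  fromBelow-indicator : ∀ F L E → (L ≡ true → F ≡ false) →
    indicator L ≡ indicator (is cpeak (cycleShapeOf F L E)) ℕ.+ indicator (is cdasc (cycleShapeOf F L E))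
  fromBelow-indicator true  true  _     moved with () ← moved ≡.refl
  fromBelow-indicator true  false _     _ = ≡.refl
  fromBelow-indicator false true  true  _ = ≡.refl
  fromBelow-indicator false true  false _ = ≡.refl
  fromBelow-indicator false false true  _ = ≡.refl
  fromBelow-indicator false false false _ = ≡.refl

module CycleStatistics {n : ℕ} (π : Perm n) (inj : IsPermutation π) where

  #shape : CycleShape → ℕ
  #shape T = # (λ a → is T (cycleShape π a))

  private
    excedance⇒moved : ∀ a → excedance π a ≡ true → isFixed π a ≡ false
    excedance⇒moved a a<πa = ≡ᵇ-false (ℕₚ.<⇒≢ (ℕₚ.<ᵇ⇒< (toℕ a) (toℕ (lookup π a)) (Equivalence.from Boolₚ.T-≡ a<πa)) ∘ ≡.sym)

    isFixed⇒fixed : ∀ a → isFixed π a ≡ true → lookup π a ≡ a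
    isFixed⇒fixed a πa≡ᵇa = Finₚ.toℕ-injective (ℕₚ.≡ᵇ⇒≡ _ _ (Equivalence.from Boolₚ.T-≡ πa≡ᵇa))

    fromBelow⇒moved : ∀ a → fromBelow π a ≡ true → isFixed π a ≡ false
    fromBelow⇒moved a from-below with isFixed π a in πa≡ᵇa
    ... | false = ≡.refl
    ... | true  with () ← ≡.trans (≡.sym from-below)
                            (≡.trans (fromBelow-preimage π inj (isFixed⇒fixed a πa≡ᵇa)) (<ᵇ-false (ℕₚ.≤-refl {toℕ a})))

  fix≡ : fix π ≡ #shape fixed
  fix≡ = ≡.trans (count-tabulate (isFixed π) id) (#-cong (λ a → fixed-indicator (isFixed π a) (fromBelow π a) (excedance π a)))

  cda≡ : cda π ≡ #shape cdasc
  cda≡ = ≡.trans (count-tabulate (λ a → excedance π a ∧ fromBelow π a) id)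
    (#-cong (λ a → cdasc-indicator (isFixed π a) (fromBelow π a) (excedance π a) (excedance⇒moved a)))

  exc≡ : exc π ≡ #shape cvalley ℕ.+ #shape cdasc
  exc≡ = ≡.trans (count-tabulate (excedance π) id)
    (#-split (excedance π) _ _ (λ a → excedance-indicator (isFixed π a) (fromBelow π a) (excedance π a) (excedance⇒moved a)))

  -- Counting the pairs a < π a by their larger end and by their smaller end.
  #cpeak≡#cvalley : #shape cpeak ≡ #shape cvalley
  #cpeak≡#cvalley = ℕₚ.+-cancelʳ-≡ (#shape cdasc) (#shape cpeak) (#shape cvalley) (begin
    #shape cpeak ℕ.+ #shape cdasc
      ≡⟨ #-split (fromBelow π) _ _ (λ a → fromBelow-indicator (isFixed π a) (fromBelow π a) (excedance π a) (fromBelow⇒moved a)) ⟨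
    # (fromBelow π)
      ≡⟨ sum-reindex ℕₚ.+-*-commutativeSemiring π inj (indicator ∘ fromBelow π) ⟩
    # (fromBelow π ∘ lookup π)
      ≡⟨ #-cong (λ c → fromBelow-preimage π inj {i = c} ≡.refl) ⟩
    # (excedance π)
      ≡⟨ ≡.trans (≡.sym (count-tabulate (excedance π) id)) exc≡ ⟩
    #shape cvalley ℕ.+ #shape cdasc ∎)
    where open ≡.≡-Reasoning

  fix≤n : fix π ≤ n
  fix≤n = begin
    fix π                                                    ≡⟨ fix≡ ⟩
    #shape fixed                                             ≤⟨ ℕₚ.m≤m+n _ _ ⟩
    #shape fixed ℕ.+ #shape cpeak                            ≤⟨ ℕₚ.m≤m+n _ _ ⟩
    #shape fixed ℕ.+ #shape cpeak ℕ.+ #shape cvalley         ≤⟨ ℕₚ.m≤m+n _ _ ⟩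
    #shape fixed ℕ.+ #shape cpeak ℕ.+ #shape cvalley ℕ.+ #shape cdasc
                                                             ≤⟨ ℕₚ.m≤m+n _ _ ⟩
    #shape fixed ℕ.+ #shape cpeak ℕ.+ #shape cvalley ℕ.+ #shape cdasc ℕ.+ #shape cddes
                                                             ≡⟨ shapes-partition (cycleShape π) ⟩
    n                                                        ∎
    where open ℕₚ.≤-Reasoning

  module _ (cda≡0 : cda π ≡ 0) where
    #cdasc≡0 : #shape cdasc ≡ 0
    #cdasc≡0 = ≡.trans (≡.sym cda≡) cda≡0

    private
      exc≡#cvalley : exc π ≡ #shape cvalley
      exc≡#cvalley = ≡.trans exc≡ (≡.trans (≡.cong (#shape cvalley ℕ.+_) #cdasc≡0) (ℕₚ.+-identityʳ _))

      fix+2exc+#cddes : fix π ℕ.+ (2 ℕ.* exc π ℕ.+ #shape cddes) ≡ n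
      fix+2exc+#cddes = ≡.trans (regroup (fix π) (exc π) (#shape cddes))
        (≡.trans (≡.cong₂ (λ F V → F ℕ.+ V ℕ.+ V ℕ.+ 0 ℕ.+ #shape cddes) fix≡ exc≡#cvalley)
          (≡.trans (≡.cong₂ (λ P A → #shape fixed ℕ.+ P ℕ.+ #shape cvalley ℕ.+ A ℕ.+ #shape cddes) (≡.sym #cpeak≡#cvalley) (≡.sym #cdasc≡0))
            (shapes-partition (cycleShape π))))
        where
        open import Data.Nat.Solver using (module +-*-Solver)
        open +-*-Solver
        regroup : ∀ f v d → f ℕ.+ (2 ℕ.* v ℕ.+ d) ≡ f ℕ.+ v ℕ.+ v ℕ.+ 0 ℕ.+ d
        regroup = solve 3 (λ f v d → f :+ (con 2 :* v :+ d) := f :+ v :+ v :+ con 0 :+ d) ≡.refl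

    #cddes≡ : #shape cddes ≡ n ∸ fix π ∸ 2 ℕ.* exc π
    #cddes≡ = ≡.sym (≡.trans (≡.cong (λ k → k ∸ fix π ∸ 2 ℕ.* exc π) (≡.sym fix+2exc+#cddes))
                (≡.trans (≡.cong (_∸ 2 ℕ.* exc π) (ℕₚ.m+n∸m≡n (fix π) _)) (ℕₚ.m+n∸m≡n (2 ℕ.* exc π) _)))

    exc≤ : exc π ≤ ⌊ n ∸ fix π /2⌋
    exc≤ = ℕₚ.≤-trans (ℕₚ.≤-reflexive (ℕₚ.n≡⌊n+n/2⌋ (exc π))) (ℕₚ.⌊n/2⌋-mono (≡.subst (_≤ n ∸ fix π) 2exc≡ 2exc≤))
      where
      2exc≡ : 2 ℕ.* exc π ≡ exc π ℕ.+ exc π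
      2exc≡ = ≡.cong (exc π ℕ.+_) (ℕₚ.+-identityʳ (exc π))
      2exc≤ : 2 ℕ.* exc π ≤ n ∸ fix π
      2exc≤ = ≡.subst (2 ℕ.* exc π ≤_) (≡.trans (≡.sym (ℕₚ.m+n∸m≡n (fix π) _)) (≡.cong (_∸ fix π) fix+2exc+#cddes)) (ℕₚ.m≤m+n _ _)

module _ {c ℓ : Level} (R : CommutativeSemiring c ℓ) where
  open CommutativeSemiring R hiding (zero)
  open FinSums R
  open NaturalSolver R
  open import Relation.Binary.Reasoning.Setoid setoid

  product-cycleWeight : ∀ {n} (S : Fin n → CycleShape) q x y f →
    product (λ a → cycleWeight R q x y f (S a)) ≈
    pow R f (# (is fixed ∘ S)) * pow R q (# (is cvalley ∘ S)) * pow R x (# (is cdasc ∘ S)) * pow R y (# (is cddes ∘ S))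
  product-cycleWeight {zero}  S q x y f = solve 0 (con 1 := con 1 :* con 1 :* con 1 :* con 1) refl
  product-cycleWeight {suc n} S q x y f = begin
    cycleWeight R q x y f (S zero) * product (λ a → cycleWeight R q x y f (S (suc a)))
      ≈⟨ *-cong (single (S zero)) (product-cycleWeight (S ∘ suc) q x y f) ⟩
    (pow R f (at fixed) * pow R q (at cvalley) * pow R x (at cdasc) * pow R y (at cddes))
      * (pow R f (rest fixed) * pow R q (rest cvalley) * pow R x (rest cdasc) * pow R y (rest cddes))
      ≈⟨ solve 8 (λ a b c d a′ b′ c′ d′ → (a :* b :* c :* d) :* (a′ :* b′ :* c′ :* d′) := (a :* a′) :* (b :* b′) :* (c :* c′) :* (d :* d′))
               refl _ _ _ _ _ _ _ _ ⟩
    (pow R f (at fixed) * pow R f (rest fixed)) * (pow R q (at cvalley) * pow R q (rest cvalley))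
      * (pow R x (at cdasc) * pow R x (rest cdasc)) * (pow R y (at cddes) * pow R y (rest cddes))
      ≈⟨ *-cong (*-cong (*-cong (pow-+ R f (at fixed) (rest fixed)) (pow-+ R q (at cvalley) (rest cvalley)))
                         (pow-+ R x (at cdasc) (rest cdasc))) (pow-+ R y (at cddes) (rest cddes)) ⟨
    pow R f (# (is fixed ∘ S)) * pow R q (# (is cvalley ∘ S)) * pow R x (# (is cdasc ∘ S)) * pow R y (# (is cddes ∘ S)) ∎
    where
    at rest : CycleShape → ℕ
    at T = indicator (is T (S zero))
    rest T = # (is T ∘ S ∘ suc)
    single : ∀ T → cycleWeight R q x y f T ≈
      pow R f (indicator (is fixed T)) * pow R q (indicator (is cvalley T))
        * pow R x (indicator (is cdasc T)) * pow R y (indicator (is cddes T))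
    single fixed   = solve 1 (λ f → f := f :* con 1 :* con 1 :* con 1 :* con 1) refl f
    single cpeak   = solve 0 (con 1 := con 1 :* con 1 :* con 1 :* con 1) refl
    single cvalley = solve 1 (λ q → q := con 1 :* (q :* con 1) :* con 1 :* con 1) refl q
    single cdasc   = solve 1 (λ x → x := con 1 :* con 1 :* (x :* con 1) :* con 1) refl x
    single cddes   = solve 1 (λ y → y := con 1 :* con 1 :* con 1 :* (y :* con 1)) refl y

  module _ {n : ℕ} (π : Perm n) (inj : IsPermutation π) (q e f : Carrier) where
    open CycleStatistics π inj

    cycleWeight-cda≢0 : cda π ≢ 0 → product (λ a → cycleWeight R q 0# e f (cycleShape π a)) ≈ 0#
    cycleWeight-cda≢0 cda≢0 with #shape cdasc in #cdasc≡
    ... | zero  = ⊥-elim (cda≢0 (≡.trans cda≡ #cdasc≡))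
    ... | suc k = begin
      product (λ a → cycleWeight R q 0# e f (cycleShape π a))
        ≈⟨ product-cycleWeight (cycleShape π) q 0# e f ⟩
      pow R f (#shape fixed) * pow R q (#shape cvalley) * pow R 0# (#shape cdasc) * pow R e (#shape cddes)
        ≡⟨ ≡.cong (λ k → pow R f (#shape fixed) * pow R q (#shape cvalley) * pow R 0# k * pow R e (#shape cddes)) #cdasc≡ ⟩
      pow R f (#shape fixed) * pow R q (#shape cvalley) * (0# * pow R 0# k) * pow R e (#shape cddes)
        ≈⟨ solve 4 (λ a b c d → a :* b :* (con 0 :* c) :* d := con 0) refl _ _ _ _ ⟩
      0# ∎

    cycleWeight-cda≡0 : cda π ≡ 0 →
      product (λ a → cycleWeight R q 0# e f (cycleShape π a)) ≈ pow R f (fix π) * pow R q (exc π) * pow R e (n ∸ fix π ∸ 2 ℕ.* exc π)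
    cycleWeight-cda≡0 cda≡0 = begin
      product (λ a → cycleWeight R q 0# e f (cycleShape π a))
        ≈⟨ product-cycleWeight (cycleShape π) q 0# e f ⟩
      pow R f (#shape fixed) * pow R q (#shape cvalley) * pow R 0# (#shape cdasc) * pow R e (#shape cddes)
        ≡⟨ ≡.cong₂ (λ a b → a * pow R 0# b * pow R e (#shape cddes))
             (≡.cong₂ (λ F V → pow R f F * pow R q V) (≡.sym fix≡)
               (≡.sym (≡.trans exc≡ (≡.trans (≡.cong (#shape cvalley ℕ.+_) (#cdasc≡0 cda≡0)) (ℕₚ.+-identityʳ _)))))
             (#cdasc≡0 cda≡0) ⟩
      pow R f (fix π) * pow R q (exc π) * 1# * pow R e (#shape cddes)
        ≡⟨ ≡.cong (λ d → pow R f (fix π) * pow R q (exc π) * 1# * pow R e d) (#cddes≡ cda≡0) ⟩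
      pow R f (fix π) * pow R q (exc π) * 1# * pow R e (n ∸ fix π ∸ 2 ℕ.* exc π)
        ≈⟨ *-cong (*-identityʳ _) refl ⟩
      pow R f (fix π) * pow R q (exc π) * pow R e (n ∸ fix π ∸ 2 ℕ.* exc π) ∎

module _ {c ℓ : Level} (R : CommutativeSemiring c ℓ) (n : ℕ) (q e f : CommutativeSemiring.Carrier R) where
  open CommutativeSemiring R hiding (zero)
  open FinSums R using (product)
  open NaturalSolver R
  open import Relation.Binary.Reasoning.Setoid setoid
  private
    K : ℕ → ℕ → Carrier
    K i j = pow R q j * pow R e (n ∸ i ∸ 2 ℕ.* j)

    selects : Perm n → ℕ → ℕ → Bool
    selects π i j = (cda π ≡ᵇ 0) ∧ (fix π ≡ᵇ i) ∧ (exc π ≡ᵇ j)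

    ι : Perm n → ℕ → ℕ → Carrier
    ι π i j = if selects π i j then 1# else 0#

    inner : Perm n → ℕ → Carrier
    inner π i = sumTo R ⌊ n ∸ i /2⌋ (λ j → K i j * ι π i j)

    unselected : ∀ π i j → selects π i j ≡ false → K i j * ι π i j ≈ 0#
    unselected π i j off = trans (*-cong refl (reflexive (≡.cong (λ b → if b then 1# else 0#) off))) (zeroʳ _)

    inner-unselected : ∀ π i → (∀ j → selects π i j ≡ false) → pow R f i * inner π i ≈ 0#
    inner-unselected π i off = trans (*-cong refl (sumTo-zero R ⌊ n ∸ i /2⌋ _ (λ j _ → unselected π i j (off j)))) (zeroʳ _)

    grouped : ∀ π → IsPermutation π → sumTo R n (λ i → pow R f i * inner π i) ≈ product (λ a → cycleWeight R q 0# e f (cycleShape π a))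
    grouped π inj with cda π ℕₚ.≟ 0
    ... | no cda≢0 = trans (sumTo-zero R n _ (λ i _ → inner-unselected π i (λ j →
                             ≡.cong (_∧ ((fix π ≡ᵇ i) ∧ (exc π ≡ᵇ j))) (≡ᵇ-false cda≢0))))
                           (sym (cycleWeight-cda≢0 R π inj q e f cda≢0))
    ... | yes cda≡0 = begin
      sumTo R n (λ i → pow R f i * inner π i)
        ≈⟨ sumTo-single R n (fix π) _ fix≤n (λ i i≢fix → inner-unselected π i (λ j →
             ≡.cong₂ _∧_ cda≡ᵇ0 (≡.cong (_∧ (exc π ≡ᵇ j)) (≡ᵇ-false (i≢fix ∘ ≡.sym))))) ⟩
      pow R f (fix π) * inner π (fix π)
        ≈⟨ *-cong refl (sumTo-single R ⌊ n ∸ fix π /2⌋ (exc π) _ (exc≤ cda≡0)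
                         (λ j j≢exc → unselected π (fix π) j
                            (≡.cong₂ _∧_ cda≡ᵇ0 (≡.cong₂ _∧_ (≡ᵇ-true (fix π)) (≡ᵇ-false (j≢exc ∘ ≡.sym)))))) ⟩
      pow R f (fix π) * (K (fix π) (exc π) * ι π (fix π) (exc π))
        ≈⟨ *-cong refl (*-cong refl (reflexive (≡.cong (λ b → if b then 1# else 0#)
             (≡.cong₂ _∧_ cda≡ᵇ0 (≡.cong₂ _∧_ (≡ᵇ-true (fix π)) (≡ᵇ-true (exc π))))))) ⟩
      pow R f (fix π) * (K (fix π) (exc π) * 1#)
        ≈⟨ solve 3 (λ a b c → a :* ((b :* c) :* con 1) := a :* b :* c) refl _ _ _ ⟩
      pow R f (fix π) * pow R q (exc π) * pow R e (n ∸ fix π ∸ 2 ℕ.* exc π)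
        ≈⟨ cycleWeight-cda≡0 R π inj q e f cda≡0 ⟨
      product (λ a → cycleWeight R q 0# e f (cycleShape π a)) ∎
      where
      open CycleStatistics π inj using (fix≤n; exc≤)
      cda≡ᵇ0 : (cda π ≡ᵇ 0) ≡ true
      cda≡ᵇ0 = ≡.cong (_≡ᵇ 0) cda≡0

  Cyc≈γ : Cyc R n q 0# e f ≈
    sumTo R n (λ i → pow R f i * sumTo R ⌊ n ∸ i /2⌋ (λ j → nat R (γ1 n i j) * pow R q j * pow R e (n ∸ i ∸ 2 ℕ.* j)))
  Cyc≈γ = sym (begin
    sumTo R n (λ i → pow R f i * sumTo R ⌊ n ∸ i /2⌋ (λ j → nat R (γ1 n i j) * pow R q j * pow R e (n ∸ i ∸ 2 ℕ.* j)))
      ≈⟨ sumTo-cong R n (λ i → *-cong refl (sumTo-cong R ⌊ n ∸ i /2⌋ (λ j → γ-term i j))) ⟩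
    sumTo R n (λ i → pow R f i * sumTo R ⌊ n ∸ i /2⌋ (λ j → sumList R (λ π → K i j * ι π i j) (𝔖 n)))
      ≈⟨ sumTo-cong R n (λ i → *-cong refl (sumTo-sumList R ⌊ n ∸ i /2⌋ (λ j π → K i j * ι π i j) (𝔖 n))) ⟩
    sumTo R n (λ i → pow R f i * sumList R (λ π → inner π i) (𝔖 n))
      ≈⟨ sumTo-cong R n (λ i → *-distribˡ-sumList R (pow R f i) _ (𝔖 n)) ⟩
    sumTo R n (λ i → sumList R (λ π → pow R f i * inner π i) (𝔖 n))
      ≈⟨ sumTo-sumList R n (λ i π → pow R f i * inner π i) (𝔖 n) ⟩
    sumList R (λ π → sumTo R n (λ i → pow R f i * inner π i)) (𝔖 n)
      ≈⟨ sumList-cong-∈ R (𝔖 n) (λ π π∈𝔖 → grouped π (∈-𝔖⁻ π∈𝔖)) ⟩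
    Cyc R n q 0# e f ∎)
    where
    γ-term : ∀ i j → nat R (γ1 n i j) * pow R q j * pow R e (n ∸ i ∸ 2 ℕ.* j) ≈ sumList R (λ π → K i j * ι π i j) (𝔖 n)
    γ-term i j = begin
      nat R (γ1 n i j) * pow R q j * pow R e (n ∸ i ∸ 2 ℕ.* j)
        ≈⟨ solve 3 (λ g a b → g :* a :* b := (a :* b) :* g) refl _ _ _ ⟩
      K i j * nat R (γ1 n i j)
        ≈⟨ *-cong refl (nat-count R (λ π → selects π i j) (𝔖 n)) ⟩
      K i j * sumList R (λ π → ι π i j) (𝔖 n)
        ≈⟨ *-distribˡ-sumList R (K i j) _ (𝔖 n) ⟩
      sumList R (λ π → K i j * ι π i j) (𝔖 n) ∎

corollary4p7 : {c ℓ : Level} (R : CommutativeSemiring c ℓ) (n : ℕ)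
    (α₁ α₂ α₃ α₄ : CommutativeSemiring.Carrier R) →
    CommutativeSemiring._≈_ R
      (A R (suc n) α₁ α₂ α₃ α₄ (CommutativeSemiring.0# R))
      (rhs R n α₁ α₂ α₃ α₄)
corollary4p7 R n α₁ α₂ α₃ α₄ = begin
  A R (suc n) α₁ α₂ α₃ α₄ 0#               ≈⟨ A≈Atop R n α₁ α₂ α₃ α₄ ⟩
  Atop R n α₁ α₂ α₃ α₄ α₁                  ≈⟨ Atop≈Cyc R n α₁ α₂ α₃ α₄ α₁ ⟩
  α₁ * Cyc R n (α₁ * α₂) 0# (α₃ + α₄) α₄   ≈⟨ *-cong refl (Cyc≈γ R n (α₁ * α₂) (α₃ + α₄) α₄) ⟩
  α₁ * sumTo R n (λ i → pow R α₄ i * sumTo R ⌊ n ∸ i /2⌋ (λ j → γ-term i j * pow R (α₁ * α₂) j * pow R (α₃ + α₄) (n ∸ i ∸ 2 ℕ.* j)))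
    ≈⟨ trans (*-distribˡ-sumTo R n α₁ _) (sumTo-cong R n (λ i →
         trans (solve 3 (λ a p s → a :* (p :* s) := p :* (a :* s)) refl α₁ (pow R α₄ i) _)
               (*-cong refl (trans (*-distribˡ-sumTo R ⌊ n ∸ i /2⌋ α₁ _) (sumTo-cong R ⌊ n ∸ i /2⌋ (absorb-α₁ i)))))) ⟩
  rhs R n α₁ α₂ α₃ α₄ ∎
  where
  open CommutativeSemiring R hiding (zero)
  open NaturalSolver R
  open import Relation.Binary.Reasoning.Setoid setoid
  γ-term : ℕ → ℕ → Carrier
  γ-term i j = nat R (γ1 n i j)
  absorb-α₁ : ∀ i j → α₁ * (γ-term i j * pow R (α₁ * α₂) j * pow R (α₃ + α₄) (n ∸ i ∸ 2 ℕ.* j)) ≈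
                      γ-term i j * pow R α₁ (suc j) * pow R α₂ j * pow R (α₃ + α₄) (n ∸ i ∸ 2 ℕ.* j)
  absorb-α₁ i j = trans (*-cong refl (*-cong (*-cong refl (pow-* R α₁ α₂ j)) refl))
    (solve 5 (λ a g p₁ p₂ E → a :* (g :* (p₁ :* p₂) :* E) := g :* (a :* p₁) :* p₂ :* E) refl α₁ _ _ _ _)
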